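{- With probability $1-o(1)$ as $k\to\infty$, a uniformly random permutation $\pi\in\mathcal{S}_k$ satisfies $L_\Delta(\pi)\le 3\sqrt{k}$ for all $\Delta\in[k]$.
   Context: For $\pi\in\mathcal{S}_k$ and $\Delta\in[k]$, a set $A\subseteq[k]$ is a $\Delta$-shift of a set $B\subseteq[k]$ in $\pi$ if $|A|=|B|=L$ and, writing $a_1<\dots<a_L$ for the elements of $A$ and $b_1<\dots<b_L$ for those of $B$, we have $\pi(a_i)=\pi(b_i)+\Delta$ for each $i$. $L_\Delta(\pi)$ is the largest $L$ for which there are $L$-sets $A,B\subseteq[k]$ with $A$ a $\Delta$-shift of $B$ in $\pi$. -}

module Defs where

open import Data.Nat using (ℕ; zero; suc; _+_; _*_; _≤_; _⊔_)
open import Data.Nat.Properties using (_≤?_)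
open import Data.Fin using (Fin; toℕ) renaming (zero to fzero; suc to fsuc)
open import Data.Fin.Properties using (all?; _≟_)
open import Data.Fin.Subset using (Subset; ∣_∣)
open import Data.Bool using (Bool; true; false; if_then_else_)
open import Data.Vec using (Vec; []; _∷_; lookup)
open import Data.List using (List; []; _∷_; [_]; map; concatMap; allFin; filter; length; foldr; cartesianProduct)
open import Data.List.Relation.Binary.Pointwise using (Pointwise)
open import Data.List.Relation.Binary.Pointwise.Properties using (decidable)
open import Data.Product using (_×_; _,_)
open import Relation.Binary.PropositionalEquality using (_≡_)
open import Relation.Nullary using (Dec; does; ¬?; _→-dec_; _×-dec_)
open import Data.Nat.Properties using () renaming (_≟_ to _≟ℕ_)

allVecsOf : {A : Set} → List A → (n : ℕ) → List (Vec A n)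
allVecsOf xs zero = [ [] ]
allVecsOf xs (suc n) = concatMap (λ v → map (λ x → x ∷ v) xs) (allVecsOf xs n)

-- all maps [k] → [k], with [k] represented by Fin k (i ↦ i+1)
allMaps : (k : ℕ) → List (Fin k → Fin k)
allMaps k = map lookup (allVecsOf (allFin k) k)

-- injective self-maps of a finite set = permutations in S_k
IsPerm : {k : ℕ} → (Fin k → Fin k) → Set
IsPerm {k} π = ∀ (i j : Fin k) → π i ≡ π j → i ≡ j

isPerm? : {k : ℕ} → (π : Fin k → Fin k) → Dec (IsPerm π)
isPerm? π = all? (λ i → all? (λ j → (π i ≟ π j) →-dec (i ≟ j)))

allSubsets : (k : ℕ) → List (Subset k)
allSubsets k = allVecsOf (true ∷ false ∷ []) k

-- elements of a subset in increasing order a₁ < … < a_L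
elems : {n : ℕ} → Subset n → List (Fin n)
elems [] = []
elems (true ∷ p) = fzero ∷ map fsuc (elems p)
elems (false ∷ p) = map fsuc (elems p)

-- A is a Δ-shift of B in π : |A| = |B| and π(a_i) = π(b_i) + Δ for all i
-- (Pointwise on the increasing enumerations forces equal lengths)
IsShift : {k : ℕ} → (Fin k → Fin k) → ℕ → Subset k → Subset k → Set
IsShift π Δ A B = Pointwise (λ a b → toℕ (π a) ≡ toℕ (π b) + Δ) (elems A) (elems B)

isShift? : {k : ℕ} → (π : Fin k → Fin k) → (Δ : ℕ) → (A B : Subset k) → Dec (IsShift π Δ A B)
isShift? π Δ A B = decidable (λ a b → toℕ (π a) ≟ℕ (toℕ (π b) + Δ)) (elems A) (elems B)

LΔ : {k : ℕ} → (Fin k → Fin k) → ℕ → ℕ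
LΔ {k} π Δ = foldr _⊔_ 0
  (map (λ { (A , B) → if does (isShift? π Δ A B) then ∣ A ∣ else 0 })
       (cartesianProduct (allSubsets k) (allSubsets k)))

-- L_Δ(π) ≤ 3 √k  ⇔  L_Δ(π)² ≤ 9k ; Δ ranges over [k] = {1,…,k}, Δ = 1 + toℕ i
Good : {k : ℕ} → (Fin k → Fin k) → Set
Good {k} π = ∀ (i : Fin k) → LΔ π (suc (toℕ i)) * LΔ π (suc (toℕ i)) ≤ 9 * k

good? : {k : ℕ} → (π : Fin k → Fin k) → Dec (Good π)
good? {k} π = all? (λ i → LΔ π (suc (toℕ i)) * LΔ π (suc (toℕ i)) ≤? 9 * k)

permCount : ℕ → ℕ
permCount k = length (filter isPerm? (allMaps k))

badCount : ℕ → ℕ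
badCount k = length (filter (λ π → isPerm? π ×-dec ¬? (good? π)) (allMaps k))

-- Fix Δ and two L-sets A, B. A permutation π for which A is a Δ-shift of B is determined by its
-- restriction g to the u positions of A ∪ B together with an extension of g to the other k − u positions.
-- In g the larger position of each of the L pairs is forced by the smaller one, so there are at most
-- k^(u − L) restrictions and (k − u)! extensions; as u ≤ 2L this gives at most k^L k! / (k − 2L)^(2L)
-- such permutations. A bad permutation has a Δ-shift between two T-sets, T being the least integer
-- above 3√k. Summing over the k·C(k,T)² choices of (Δ, A, B) and using C(k,T) T! ≤ k^T,
-- T! ≥ (0.9¹⁰ T)^T and T² > 9k, the proportion of bad permutations is at most k (20/21)^T → 0.

module Submission where

open import Defs
open import Data.Nat
open import Data.Nat.Properties
open import Data.Nat.ListAction using (sum)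
open import Data.Nat.Solver using (module +-*-Solver)
open import Algebra.Properties.CommutativeSemigroup +-commutativeSemigroup using () renaming (interchange to +-interchange)
open import Algebra.Properties.CommutativeSemigroup *-commutativeSemigroup using (x∙yz≈y∙xz) renaming (interchange to *-interchange)
open import Data.Bool using (true; false)
open import Data.Empty using (⊥; ⊥-elim)
open import Data.Fin using (Fin; toℕ) renaming (zero to fzero; suc to fsuc)
open import Data.Fin.Properties using (toℕ-injective; toℕ<n; ¬∀⟶∃¬) renaming (_≟_ to _≟ᶠ_)
import Data.Fin.Properties as Fin
open import Data.Fin.Subset using (Subset; ∣_∣)
open import Data.List using (List; []; _∷_; _++_; map; concatMap; length; filter; allFin; mapMaybe; downFrom; take; zipWith; foldr; cartesianProduct)
open import Data.List.Properties using (length-filter; map-cong; length-map; length-++; length-tabulate; length-downFrom; take-map; length-take; length-zipWith)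
open import Data.List.Membership.Propositional using (_∈_; _∉_)
open import Data.List.Membership.Propositional.Properties
  using (∈-allFin; ∈-map⁺; ∈-map⁻; ∈-concat⁺′; ∈-++⁻; ∈-++⁺ˡ; ∈-++⁺ʳ; ∈-downFrom⁺; ∈-downFrom⁻; ∈-filter⁺; ∈-filter⁻; ∈-cartesianProduct⁺; ∈-cartesianProduct⁻)
open import Data.List.Relation.Unary.Any using (here; there)
open import Data.List.Relation.Unary.All as All using (All; []; _∷_)
open import Data.List.Relation.Unary.All.Properties.Core using (¬Any⇒All¬)
import Data.List.Relation.Unary.All.Properties as All
open import Data.List.Relation.Unary.AllPairs as AllPairs using (AllPairs; []; _∷_)
import Data.List.Relation.Unary.AllPairs.Properties as AllPairs
open import Data.List.Relation.Unary.Unique.Propositional using (Unique)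
import Data.List.Relation.Unary.Unique.Propositional.Properties as Unique
open import Data.List.Relation.Binary.Pointwise as Pointwise using (Pointwise; []; _∷_)
open import Data.List.Relation.Binary.Pointwise.Properties using (Pointwise-length)
open import Data.Maybe using (Maybe; just; nothing; _>>=_)
import Data.Maybe.Properties as Maybe
open import Data.Product using (Σ; _×_; _,_; proj₁; proj₂; ∃-syntax)
open import Data.Sum using (_⊎_; inj₁; inj₂)
open import Data.Vec using (Vec; []; _∷_; lookup; toList)
open import Data.Vec.Properties using (length-toList)
open import Data.Vec.Membership.Propositional.Properties using (∈-lookup; ∈-toList⁺)
open import Function using (id; _∘_; case_of_)
open import Relation.Binary.Definitions using (DecidableEquality)
open import Relation.Binary.PropositionalEquality
open import Relation.Nullary using (Dec; yes; no; ¬_; ¬?)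
open import Relation.Nullary.Decidable using (_×-dec_; _⊎-dec_; _→-dec_; decidable-stable)
open import Relation.Unary using (Decidable)

open +-*-Solver

-- Counting

private variable
  A B W X Y : Set

indicator : {P : Set} → Dec P → ℕ
indicator (yes _) = 1
indicator (no _) = 0

count : {P : A → Set} → Decidable P → List A → ℕ
count P? [] = 0
count P? (x ∷ xs) = indicator (P? x) + count P? xs

module _ {P : A → Set} (P? : Decidable P) where

  length-filter≡count : ∀ xs → length (filter P? xs) ≡ count P? xs
  length-filter≡count [] = refl
  length-filter≡count (x ∷ xs) with P? x
  ... | yes _ = cong suc (length-filter≡count xs)
  ... | no _ = length-filter≡count xs

  count≤length : ∀ xs → count P? xs ≤ length xs
  count≤length xs = subst (_≤ length xs) (length-filter≡count xs) (length-filter P? xs)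

  count-++ : ∀ xs ys → count P? (xs ++ ys) ≡ count P? xs + count P? ys
  count-++ [] ys = refl
  count-++ (x ∷ xs) ys = trans (cong (indicator (P? x) +_) (count-++ xs ys)) (sym (+-assoc (indicator (P? x)) (count P? xs) (count P? ys)))

  count-map : (f : B → A) (xs : List B) → count P? (map f xs) ≡ count (λ x → P? (f x)) xs
  count-map f [] = refl
  count-map f (x ∷ xs) = cong (indicator (P? (f x)) +_) (count-map f xs)

  count≡0 : ∀ xs → (∀ {x} → x ∈ xs → ¬ P x) → count P? xs ≡ 0
  count≡0 [] _ = refl
  count≡0 (x ∷ xs) h with P? x
  ... | yes p = ⊥-elim (h (here refl) p)
  ... | no _ = count≡0 xs (h ∘ there)

  count-pos : ∀ {xs x} → x ∈ xs → P x → 1 ≤ count P? xs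
  count-pos {x ∷ xs} (here refl) p with P? x
  ... | yes _ = s≤s z≤n
  ... | no ¬p = ⊥-elim (¬p p)
  count-pos {y ∷ xs} (there x∈xs) p = ≤-trans (count-pos x∈xs p) (m≤n+m _ (indicator (P? y)))

  count≤1 : ∀ {xs} → Unique xs → (∀ {a b} → P a → P b → a ≡ b) → count P? xs ≤ 1
  count≤1 {[]} _ _ = z≤n
  count≤1 {x ∷ xs} (x∉xs ∷ u) h with P? x
  ... | yes p = s≤s (≤-reflexive (count≡0 xs (λ y∈xs q → All.lookup x∉xs y∈xs (h p q))))
  ... | no _ = count≤1 u h

indicator-mono : {P Q : Set} (p : Dec P) (q : Dec Q) → (P → Q) → indicator p ≤ indicator q
indicator-mono (yes _) (yes _) _ = ≤-refl
indicator-mono (yes p) (no ¬q) f = ⊥-elim (¬q (f p))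
indicator-mono (no _) _ _ = z≤n

indicator-⊎ : {P Q : Set} (p : Dec P) (q : Dec Q) (r : Dec (P ⊎ Q)) → indicator r ≤ indicator p + indicator q
indicator-⊎ _ _ (no _) = z≤n
indicator-⊎ (yes _) _ (yes _) = s≤s z≤n
indicator-⊎ (no _) (yes _) (yes _) = s≤s z≤n
indicator-⊎ (no ¬p) (no _) (yes (inj₁ p)) = ⊥-elim (¬p p)
indicator-⊎ (no _) (no ¬q) (yes (inj₂ q)) = ⊥-elim (¬q q)

indicator-split : {P R : Set} (p : Dec P) (r : Dec R) → indicator p ≡ indicator (p ×-dec ¬? r) + indicator (p ×-dec r)
indicator-split (yes _) (yes _) = refl
indicator-split (yes _) (no _) = refl
indicator-split (no _) (yes _) = refl
indicator-split (no _) (no _) = refl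

indicator-compl : {P : Set} (p : Dec P) (n : Dec (¬ P)) → indicator p + indicator n ≡ 1
indicator-compl (yes p) (yes ¬p) = ⊥-elim (¬p p)
indicator-compl (yes _) (no _) = refl
indicator-compl (no _) (yes _) = refl
indicator-compl (no ¬p) (no ¬¬p) = ⊥-elim (¬¬p ¬p)

count-mono : {P Q : A → Set} (P? : Decidable P) (Q? : Decidable Q) →
             ∀ xs → (∀ {x} → x ∈ xs → P x → Q x) → count P? xs ≤ count Q? xs
count-mono P? Q? [] _ = z≤n
count-mono P? Q? (x ∷ xs) f = +-mono-≤ (indicator-mono (P? x) (Q? x) (f (here refl))) (count-mono P? Q? xs (f ∘ there))

count-cong : {P Q : A → Set} (P? : Decidable P) (Q? : Decidable Q) →
             ∀ xs → (∀ {x} → x ∈ xs → P x → Q x) → (∀ {x} → x ∈ xs → Q x → P x) → count P? xs ≡ count Q? xs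
count-cong P? Q? xs f g = ≤-antisym (count-mono P? Q? xs f) (count-mono Q? P? xs g)

count-∨ : {P Q R : A → Set} (P? : Decidable P) (Q? : Decidable Q) (R? : Decidable R) →
          ∀ xs → (∀ {x} → R x → P x ⊎ Q x) → count R? xs ≤ count P? xs + count Q? xs
count-∨ P? Q? R? [] _ = z≤n
count-∨ P? Q? R? (x ∷ xs) f = begin
  indicator (R? x) + count R? xs
    ≤⟨ +-mono-≤ (≤-trans (indicator-mono (R? x) (P? x ⊎-dec Q? x) f) (indicator-⊎ (P? x) (Q? x) (P? x ⊎-dec Q? x)))
                (count-∨ P? Q? R? xs f) ⟩
  (indicator (P? x) + indicator (Q? x)) + (count P? xs + count Q? xs)
    ≡⟨ +-interchange (indicator (P? x)) (indicator (Q? x)) (count P? xs) (count Q? xs) ⟩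
  count P? (x ∷ xs) + count Q? (x ∷ xs) ∎
  where open ≤-Reasoning

count-split : {P R : A → Set} (P? : Decidable P) (R? : Decidable R) →
  ∀ xs → count P? xs ≡ count (λ x → P? x ×-dec ¬? (R? x)) xs + count (λ x → P? x ×-dec R? x) xs
count-split P? R? [] = refl
count-split P? R? (x ∷ xs) = begin
  indicator (P? x) + count P? xs
    ≡⟨ cong₂ _+_ (indicator-split (P? x) (R? x)) (count-split P? R? xs) ⟩
  (indicator (P? x ×-dec ¬? (R? x)) + indicator (P? x ×-dec R? x))
    + (count (λ x → P? x ×-dec ¬? (R? x)) xs + count (λ x → P? x ×-dec R? x) xs)
    ≡⟨ +-interchange (indicator (P? x ×-dec ¬? (R? x))) (indicator (P? x ×-dec R? x)) _ _ ⟩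
  count (λ x → P? x ×-dec ¬? (R? x)) (x ∷ xs) + count (λ x → P? x ×-dec R? x) (x ∷ xs) ∎
  where open ≡-Reasoning

count+count-¬≡length : {P : A → Set} (P? : Decidable P) → ∀ xs → count P? xs + count (¬? ∘ P?) xs ≡ length xs
count+count-¬≡length P? [] = refl
count+count-¬≡length P? (x ∷ xs) = begin
  (indicator (P? x) + count P? xs) + (indicator (¬? (P? x)) + count (¬? ∘ P?) xs)
    ≡⟨ +-interchange (indicator (P? x)) (count P? xs) _ _ ⟩
  (indicator (P? x) + indicator (¬? (P? x))) + (count P? xs + count (¬? ∘ P?) xs)
    ≡⟨ cong₂ _+_ (indicator-compl (P? x) (¬? (P? x))) (count+count-¬≡length P? xs) ⟩
  suc (length xs) ∎
  where open ≡-Reasoning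

count≡sum-indicator : {P : A → Set} (P? : Decidable P) → ∀ xs → count P? xs ≡ sum (map (indicator ∘ P?) xs)
count≡sum-indicator P? [] = refl
count≡sum-indicator P? (x ∷ xs) = cong (indicator (P? x) +_) (count≡sum-indicator P? xs)

count-concatMap : {P : A → Set} (P? : Decidable P) (f : B → List A) →
                  ∀ xs → count P? (concatMap f xs) ≡ sum (map (count P? ∘ f) xs)
count-concatMap P? f [] = refl
count-concatMap P? f (x ∷ xs) = trans (count-++ P? (f x) (concatMap f xs)) (cong (count P? (f x) +_) (count-concatMap P? f xs))

sum-map-mono : (f g : A → ℕ) → ∀ xs → (∀ {x} → x ∈ xs → f x ≤ g x) → sum (map f xs) ≤ sum (map g xs)
sum-map-mono f g [] _ = z≤n
sum-map-mono f g (x ∷ xs) h = +-mono-≤ (h (here refl)) (sum-map-mono f g xs (h ∘ there))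

sum-map-+ : (f g : A → ℕ) → ∀ xs → sum (map (λ x → f x + g x) xs) ≡ sum (map f xs) + sum (map g xs)
sum-map-+ f g [] = refl
sum-map-+ f g (x ∷ xs) = trans (cong (f x + g x +_) (sum-map-+ f g xs)) (+-interchange (f x) (g x) _ _)

sum-map-const0 : ∀ (xs : List A) → sum (map (λ _ → 0) xs) ≡ 0
sum-map-const0 [] = refl
sum-map-const0 (_ ∷ xs) = sum-map-const0 xs

sum-map-const : (c : ℕ) → ∀ (xs : List A) → sum (map (λ _ → c) xs) ≡ length xs * c
sum-map-const c [] = refl
sum-map-const c (_ ∷ xs) = cong (c +_) (sum-map-const c xs)

sum-map-*ʳ : (f : A → ℕ) (c : ℕ) → ∀ xs → sum (map f xs) * c ≡ sum (map (λ x → f x * c) xs)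
sum-map-*ʳ f c [] = refl
sum-map-*ʳ f c (x ∷ xs) = trans (*-distribʳ-+ c (f x) (sum (map f xs))) (cong (f x * c +_) (sum-map-*ʳ f c xs))

sum-map-swap : (h : A → W → ℕ) → ∀ xs ws →
  sum (map (λ x → sum (map (h x) ws)) xs) ≡ sum (map (λ w → sum (map (λ x → h x w) xs)) ws)
sum-map-swap h [] ws = sym (sum-map-const0 ws)
sum-map-swap h (x ∷ xs) ws =
  trans (cong (sum (map (h x) ws) +_) (sum-map-swap h xs ws)) (sym (sum-map-+ (h x) (λ w → sum (map (λ x → h x w) xs)) ws))

module _ {P : A → Set} (P? : Decidable P) where

  sum-map≤count* : (f : A → ℕ) (c : ℕ) → (∀ {x} → P x → f x ≤ c) → (∀ {x} → ¬ P x → f x ≡ 0) →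
                   ∀ xs → sum (map f xs) ≤ count P? xs * c
  sum-map≤count* f c below vanish xs = begin
    sum (map f xs)                              ≤⟨ sum-map-mono f (λ x → indicator (P? x) * c) xs (λ {x} _ → bound x) ⟩
    sum (map (λ x → indicator (P? x) * c) xs)   ≡⟨ sum-map-*ʳ (indicator ∘ P?) c xs ⟨
    sum (map (indicator ∘ P?) xs) * c           ≡⟨ cong (_* c) (count≡sum-indicator P? xs) ⟨
    count P? xs * c                             ∎
    where
    open ≤-Reasoning
    bound : ∀ x → f x ≤ indicator (P? x) * c
    bound x with P? x
    ... | yes p = ≤-trans (below p) (≤-reflexive (sym (+-identityʳ c)))
    ... | no ¬p = ≤-reflexive (vanish ¬p)

  count*≤sum-map : (f : A → ℕ) (c : ℕ) → (∀ {x} → P x → c ≤ f x) → ∀ xs → count P? xs * c ≤ sum (map f xs)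
  count*≤sum-map f c above xs = begin
    count P? xs * c                             ≡⟨ cong (_* c) (count≡sum-indicator P? xs) ⟩
    sum (map (indicator ∘ P?) xs) * c           ≡⟨ sum-map-*ʳ (indicator ∘ P?) c xs ⟩
    sum (map (λ x → indicator (P? x) * c) xs)   ≤⟨ sum-map-mono (λ x → indicator (P? x) * c) f xs (λ {x} _ → bound x) ⟩
    sum (map f xs)                              ∎
    where
    open ≤-Reasoning
    bound : ∀ x → indicator (P? x) * c ≤ f x
    bound x with P? x
    ... | yes p = ≤-trans (≤-reflexive (+-identityʳ c)) (above p)
    ... | no _ = z≤n

  count≤sum-count : {Q : W → A → Set} (Q? : ∀ w → Decidable (Q w)) (ws : List W) →
                    (∀ {x} → P x → Σ W (λ w → w ∈ ws × Q w x)) →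
                    ∀ xs → count P? xs ≤ sum (map (λ w → count (Q? w) xs) ws)
  count≤sum-count Q? ws witness xs = begin
    count P? xs                                             ≡⟨ count≡sum-indicator P? xs ⟩
    sum (map (indicator ∘ P?) xs)                           ≤⟨ sum-map-mono _ _ xs (λ {x} _ → covered x) ⟩
    sum (map (λ x → sum (map (λ w → indicator (Q? w x)) ws)) xs)
                                                            ≡⟨ sum-map-swap (λ x w → indicator (Q? w x)) xs ws ⟩
    sum (map (λ w → sum (map (indicator ∘ Q? w) xs)) ws)   ≡⟨ cong sum (map-cong (λ w → count≡sum-indicator (Q? w) xs) ws) ⟨
    sum (map (λ w → count (Q? w) xs) ws)                    ∎
    where
    open ≤-Reasoning
    covered : ∀ x → indicator (P? x) ≤ sum (map (λ w → indicator (Q? w x)) ws)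
    covered x with P? x
    ... | no _ = z≤n
    ... | yes p = let (w , w∈ws , q) = witness p in
                  ≤-trans (count-pos (λ w → Q? w x) w∈ws q) (≤-reflexive (count≡sum-indicator (λ w → Q? w x) ws))

module _ {A : Set} (_≟_ : DecidableEquality A) where

  open import Data.List.Membership.DecPropositional _≟_ using (_∈?_)

  count-∈≤length : ∀ {xs} → Unique xs → (ys : List A) → count (_∈? ys) xs ≤ length ys
  count-∈≤length {xs} _ [] = ≤-reflexive (count≡0 (_∈? []) xs (λ _ ()))
  count-∈≤length {xs} u (y ∷ ys) = begin
    count (_∈? (y ∷ ys)) xs
      ≤⟨ count-∨ (_≟ y) (_∈? ys) (_∈? (y ∷ ys)) xs ∈-∷⁻ ⟩
    count (_≟ y) xs + count (_∈? ys) xs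
      ≤⟨ +-mono-≤ (count≤1 (_≟ y) u (λ a≡y b≡y → trans a≡y (sym b≡y))) (count-∈≤length u ys) ⟩
    suc (length ys) ∎
    where
    open ≤-Reasoning
    ∈-∷⁻ : ∀ {x} → x ∈ y ∷ ys → x ≡ y ⊎ x ∈ ys
    ∈-∷⁻ (here x≡y) = inj₁ x≡y
    ∈-∷⁻ (there x∈ys) = inj₂ x∈ys

  length≤count-∈ : ∀ {ys} → Unique ys → (xs : List A) → (∀ {y} → y ∈ ys → y ∈ xs) → length ys ≤ count (_∈? ys) xs
  length≤count-∈ {[]} _ _ _ = z≤n
  length≤count-∈ {y ∷ ys} (y∉ys ∷ u) xs ys⊆xs = begin
    suc (length ys)
      ≤⟨ +-mono-≤ (count-pos (λ x → x ∈? (y ∷ ys) ×-dec x ≟ y) (ys⊆xs (here refl)) (here refl , refl))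
         (length≤count-∈ u xs (ys⊆xs ∘ there)) ⟩
    count (λ x → x ∈? (y ∷ ys) ×-dec x ≟ y) xs + count (_∈? ys) xs
      ≡⟨ +-comm (count (λ x → x ∈? (y ∷ ys) ×-dec x ≟ y) xs) (count (_∈? ys) xs) ⟩
    count (_∈? ys) xs + count (λ x → x ∈? (y ∷ ys) ×-dec x ≟ y) xs
      ≡⟨ cong (_+ count (λ x → x ∈? (y ∷ ys) ×-dec x ≟ y) xs) (count-cong (_∈? ys) (λ x → x ∈? (y ∷ ys) ×-dec ¬? (x ≟ y)) xs to from) ⟩
    count (λ x → x ∈? (y ∷ ys) ×-dec ¬? (x ≟ y)) xs + count (λ x → x ∈? (y ∷ ys) ×-dec x ≟ y) xs
      ≡⟨ count-split (_∈? (y ∷ ys)) (_≟ y) xs ⟨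
    count (_∈? (y ∷ ys)) xs ∎
    where
    open ≤-Reasoning
    to : ∀ {x} → _ → x ∈ ys → x ∈ y ∷ ys × x ≢ y
    to _ x∈ys = there x∈ys , λ { refl → All.lookup y∉ys x∈ys refl }
    from : ∀ {x} → _ → x ∈ y ∷ ys × x ≢ y → x ∈ ys
    from _ (here x≡y , x≢y) = ⊥-elim (x≢y x≡y)
    from _ (there x∈ys , _) = x∈ys

  count-∈≡length : ∀ {xs ys} → Unique xs → Unique ys → (∀ {y} → y ∈ ys → y ∈ xs) → count (_∈? ys) xs ≡ length ys
  count-∈≡length {xs} {ys} uxs uys ys⊆xs = ≤-antisym (count-∈≤length uxs ys) (length≤count-∈ uys xs ys⊆xs)

-- Counting vectors entry by entry

prod : (ℕ → ℕ) → ℕ → ℕ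
prod c zero = 1
prod c (suc n) = c n * prod c n

∈-allVecsOf : ∀ {X : Set} {xs : List X} {n} (v : Vec X n) → (∀ {x} → x ∈ xs) → v ∈ allVecsOf xs n
∈-allVecsOf [] _ = here refl
∈-allVecsOf {xs = xs} (x ∷ v) x∈xs = ∈-concat⁺′ (∈-map⁺ (_∷ v) x∈xs) (∈-map⁺ (λ w → map (_∷ w) xs) (∈-allVecsOf v x∈xs))

module _ {X : Set} (xs : List X) (P : (n : ℕ) → Vec X n → Set) (P? : ∀ n → Decidable (P n)) where

  extensions : ∀ {n} → Vec X n → ℕ
  extensions {n} v = count (λ x → P? (suc n) (x ∷ v)) xs

  count-allVecsOf-suc : ∀ n → count (P? (suc n)) (allVecsOf xs (suc n)) ≡ sum (map extensions (allVecsOf xs n))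
  count-allVecsOf-suc n = trans (count-concatMap (P? (suc n)) (λ v → map (_∷ v) xs) (allVecsOf xs n))
                                (cong sum (map-cong (λ v → count-map (P? (suc n)) (_∷ v) xs) (allVecsOf xs n)))

  count-allVecsOf≤prod : (c : ℕ → ℕ) → (∀ n x v → P (suc n) (x ∷ v) → P n v) → (∀ n v → P n v → extensions v ≤ c n) →
                         ∀ n → count (P? n) (allVecsOf xs n) ≤ prod c n
  count-allVecsOf≤prod c prefix-closed step zero with P? zero []
  ... | yes _ = ≤-refl
  ... | no _ = z≤n
  count-allVecsOf≤prod c prefix-closed step (suc n) = begin
    count (P? (suc n)) (allVecsOf xs (suc n)) ≡⟨ count-allVecsOf-suc n ⟩
    sum (map extensions (allVecsOf xs n))     ≤⟨ sum-map≤count* (P? n) extensions (c n) (step n _) dead (allVecsOf xs n) ⟩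
    count (P? n) (allVecsOf xs n) * c n       ≤⟨ *-monoˡ-≤ (c n) (count-allVecsOf≤prod c prefix-closed step n) ⟩
    prod c n * c n                            ≡⟨ *-comm (prod c n) (c n) ⟩
    prod c (suc n)                            ∎
    where
    open ≤-Reasoning
    dead : ∀ {v} → ¬ P n v → extensions v ≡ 0
    dead {v} ¬pv = count≡0 (λ x → P? (suc n) (x ∷ v)) xs (λ _ p → ¬pv (prefix-closed n _ v p))

  prod≤count-allVecsOf : (c : ℕ → ℕ) → P zero [] → (∀ n v → P n v → c n ≤ extensions v) →
                         ∀ n → prod c n ≤ count (P? n) (allVecsOf xs n)
  prod≤count-allVecsOf c base step zero with P? zero []
  ... | yes _ = ≤-refl
  ... | no ¬p = ⊥-elim (¬p base)
  prod≤count-allVecsOf c base step (suc n) = begin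
    prod c (suc n)                            ≡⟨ *-comm (c n) (prod c n) ⟩
    prod c n * c n                            ≤⟨ *-monoˡ-≤ (c n) (prod≤count-allVecsOf c base step n) ⟩
    count (P? n) (allVecsOf xs n) * c n       ≤⟨ count*≤sum-map (P? n) extensions (c n) (step n _) (allVecsOf xs n) ⟩
    sum (map extensions (allVecsOf xs n))     ≡⟨ count-allVecsOf-suc n ⟨
    count (P? (suc n)) (allVecsOf xs (suc n)) ∎
    where open ≤-Reasoning

-- Permutations

[m∸n]!≡[m∸n]*[m∸1+n]! : ∀ {m n} → n < m → (m ∸ n) ! ≡ (m ∸ n) * (m ∸ suc n) !
[m∸n]!≡[m∸n]*[m∸1+n]! {m} {n} n<m rewrite +-∸-assoc 1 n<m = refl

prod-∸*!≡! : ∀ k n → n ≤ k → prod (k ∸_) n * (k ∸ n) ! ≡ k !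
prod-∸*!≡! k zero _ = *-identityˡ (k !)
prod-∸*!≡! k (suc n) n<k = begin
  (k ∸ n) * prod (k ∸_) n * (k ∸ suc n) !   ≡⟨ cong (_* (k ∸ suc n) !) (*-comm (k ∸ n) (prod (k ∸_) n)) ⟩
  prod (k ∸_) n * (k ∸ n) * (k ∸ suc n) !   ≡⟨ *-assoc (prod (k ∸_) n) (k ∸ n) ((k ∸ suc n) !) ⟩
  prod (k ∸_) n * ((k ∸ n) * (k ∸ suc n) !) ≡⟨ cong (prod (k ∸_) n *_) ([m∸n]!≡[m∸n]*[m∸1+n]! n<k) ⟨
  prod (k ∸_) n * (k ∸ n) !                 ≡⟨ prod-∸*!≡! k n (<⇒≤ n<k) ⟩
  k !                                       ∎
  where open ≡-Reasoning

length-allFin : ∀ k → length (allFin k) ≡ k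
length-allFin k = length-tabulate {n = k} (λ i → i)

module _ {k : ℕ} where

  open import Data.List.Membership.DecPropositional (_≟ᶠ_ {k}) using (_∈?_)
  open import Data.List.Relation.Unary.Unique.DecPropositional (_≟ᶠ_ {k}) using (unique?) public

  count-∉-allFin : ∀ {ys} → Unique ys → count (λ x → ¬? (x ∈? ys)) (allFin k) ≡ k ∸ length ys
  count-∉-allFin {ys} u = begin
    count (λ x → ¬? (x ∈? ys)) (allFin k)
      ≡⟨ m+n∸m≡n (count (_∈? ys) (allFin k)) _ ⟨
    count (_∈? ys) (allFin k) + count (λ x → ¬? (x ∈? ys)) (allFin k) ∸ count (_∈? ys) (allFin k)
      ≡⟨ cong₂ _∸_ (trans (count+count-¬≡length (_∈? ys) (allFin k)) (length-allFin k))
         (count-∈≡length _≟ᶠ_ (Unique.allFin⁺ k) u (λ {y} _ → ∈-allFin y)) ⟩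
    k ∸ length ys ∎
    where open ≡-Reasoning

  unique⇒lookup-injective : ∀ {n} (v : Vec (Fin k) n) → Unique (toList v) → ∀ i j → lookup v i ≡ lookup v j → i ≡ j
  unique⇒lookup-injective (x ∷ v) _ fzero fzero _ = refl
  unique⇒lookup-injective (x ∷ v) (x∉v ∷ _) fzero (fsuc j) x≡vj = ⊥-elim (All.lookup x∉v (∈-toList⁺ (∈-lookup j v)) x≡vj)
  unique⇒lookup-injective (x ∷ v) (x∉v ∷ _) (fsuc i) fzero vi≡x = ⊥-elim (All.lookup x∉v (∈-toList⁺ (∈-lookup i v)) (sym vi≡x))
  unique⇒lookup-injective (x ∷ v) (_ ∷ u) (fsuc i) (fsuc j) vi≡vj = cong fsuc (unique⇒lookup-injective v u i j vi≡vj)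

  lookup-injective⇒unique : ∀ {n} (v : Vec (Fin k) n) → (∀ i j → lookup v i ≡ lookup v j → i ≡ j) → Unique (toList v)
  lookup-injective⇒unique [] _ = []
  lookup-injective⇒unique (x ∷ v) inj =
    head-fresh v (λ i x≡vi → Fin.0≢1+n (inj fzero (fsuc i) x≡vi))
    ∷ lookup-injective⇒unique v (λ i j e → Fin.suc-injective (inj (fsuc i) (fsuc j) e))
    where
    head-fresh : ∀ {n} (v : Vec (Fin k) n) → (∀ i → x ≢ lookup v i) → All (x ≢_) (toList v)
    head-fresh [] _ = []
    head-fresh (y ∷ v) h = h fzero ∷ head-fresh v (h ∘ fsuc)

permCount≡count-unique : ∀ k → permCount k ≡ count (λ v → unique? (toList v)) (allVecsOf (allFin k) k)
permCount≡count-unique k = begin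
  length (filter isPerm? (allMaps k))
    ≡⟨ length-filter≡count isPerm? (allMaps k) ⟩
  count isPerm? (map lookup (allVecsOf (allFin k) k))
    ≡⟨ count-map isPerm? lookup (allVecsOf (allFin k) k) ⟩
  count (λ v → isPerm? (lookup v)) (allVecsOf (allFin k) k)
    ≡⟨ count-cong _ _ (allVecsOf (allFin k) k) (λ _ → lookup-injective⇒unique _) (λ _ → unique⇒lookup-injective _) ⟩
  count (λ v → unique? (toList v)) (allVecsOf (allFin k) k) ∎
  where
  open ≡-Reasoning

k!≤permCount : ∀ k → k ! ≤ permCount k
k!≤permCount k = begin
  k !
    ≡⟨ prod-∸*!≡! k k ≤-refl ⟨
  prod (k ∸_) k * (k ∸ k) !
    ≡⟨ cong (λ n → prod (k ∸_) k * n !) (n∸n≡0 k) ⟩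
  prod (k ∸_) k * 1
    ≡⟨ *-identityʳ (prod (k ∸_) k) ⟩
  prod (k ∸_) k
    ≤⟨ prod≤count-allVecsOf (allFin k) (λ _ v → Unique (toList v)) (λ _ v → unique? (toList v)) (k ∸_) [] fresh k ⟩
  count (λ v → unique? (toList v)) (allVecsOf (allFin k) k)
    ≡⟨ permCount≡count-unique k ⟨
  permCount k ∎
  where
  open ≤-Reasoning
  open import Data.List.Membership.DecPropositional (_≟ᶠ_ {k}) using (_∈?_)
  fresh : ∀ n (v : Vec (Fin k) n) → Unique (toList v) → k ∸ n ≤ count (λ x → unique? (toList (x ∷ v))) (allFin k)
  fresh n v u = begin
    k ∸ n                                      ≡⟨ cong (k ∸_) (length-toList v) ⟨
    k ∸ length (toList v)                      ≡⟨ count-∉-allFin u ⟨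
    count (λ x → ¬? (x ∈? toList v)) (allFin k) ≤⟨ count-mono _ _ (allFin k) (λ _ x∉v → ¬Any⇒All¬ (toList v) x∉v ∷ u) ⟩
    count (λ x → unique? (toList (x ∷ v))) (allFin k) ∎

-- Positions counted from the end

-- Entries are addressed from the end: at v r is the entry of v followed by exactly r entries, so
-- consing onto a vector of length n fills position n and leaves the positions below n untouched.
at : ∀ {n} → Vec X n → ℕ → Maybe X
at [] r = nothing
at (_∷_ {n} x v) r with r ≟ n
... | yes _ = just x
... | no _ = at v r

atM : ∀ {n} → Vec (Maybe X) n → ℕ → Maybe X
atM v r = at v r >>= id

at-new : ∀ {n} (x : X) (v : Vec X n) → at (x ∷ v) n ≡ just x
at-new {n = n} x v with n ≟ n
... | yes _ = refl
... | no n≢n = ⊥-elim (n≢n refl)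

at-old : ∀ {n} (x : X) (v : Vec X n) {r} → r ≢ n → at (x ∷ v) r ≡ at v r
at-old {n = n} x v {r} r≢n with r ≟ n
... | yes r≡n = ⊥-elim (r≢n r≡n)
... | no _ = refl

atM-new : ∀ {n} (x : Maybe X) (v : Vec (Maybe X) n) → atM (x ∷ v) n ≡ x
atM-new x v = cong (_>>= id) (at-new x v)

atM-old : ∀ {n} (x : Maybe X) (v : Vec (Maybe X) n) {r} → r ≢ n → atM (x ∷ v) r ≡ atM v r
atM-old x v r≢n = cong (_>>= id) (at-old x v r≢n)

at-in : ∀ {n} (v : Vec X n) {r} → r < n → Σ X (λ a → at v r ≡ just a)
at-in (_∷_ {n} x v) {r} r<1+n with r ≟ n
... | yes _ = x , refl
... | no r≢n = at-in v (≤∧≢⇒< (≤-pred r<1+n) r≢n)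

at-just⇒< : ∀ {n} (v : Vec X n) r {a} → at v r ≡ just a → r < n
at-just⇒< (_∷_ {n} x v) r e with r ≟ n
... | yes refl = ≤-refl
... | no _ = m≤n⇒m≤1+n (at-just⇒< v r e)

atM-just⇒< : ∀ {n} (v : Vec (Maybe X) n) r {a} → atM v r ≡ just a → r < n
atM-just⇒< v r e with at v r in eq
... | just _ = at-just⇒< v r eq

at-∈ : ∀ {n} (v : Vec X n) r {a} → at v r ≡ just a → a ∈ toList v
at-∈ (_∷_ {n} x v) r e with r ≟ n
at-∈ (_∷_ {n} x v) r refl | yes _ = here refl
... | no _ = there (at-∈ v r e)

at-injective : ∀ {n} (v : Vec X n) → Unique (toList v) → ∀ r s {a} → at v r ≡ just a → at v s ≡ just a → r ≡ s
at-injective (_∷_ {n} x v) (x∉v ∷ u) r s e₁ e₂ with r ≟ n | s ≟ n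
... | yes r≡n | yes s≡n = trans r≡n (sym s≡n)
at-injective (_∷_ {n} x v) (x∉v ∷ u) r s refl e₂ | yes _ | no _ = ⊥-elim (All.lookup x∉v (at-∈ v s e₂) refl)
at-injective (_∷_ {n} x v) (x∉v ∷ u) r s e₁ refl | no _ | yes _ = ⊥-elim (All.lookup x∉v (at-∈ v r e₁) refl)
... | no _ | no _ = at-injective v u r s e₁ e₂

at-lookup : ∀ {k} (π : Vec X k) (p : Fin k) → at π (k ∸ suc (toℕ p)) ≡ just (lookup π p)
at-lookup (_∷_ {n} x π) fzero = at-new x π
at-lookup (_∷_ {n} x π) (fsuc p) =
  trans (at-old x π (<⇒≢ (∸-monoʳ-< {n} {suc (toℕ p)} {0} (s≤s z≤n) (toℕ<n p)))) (at-lookup π p)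

prod-pow-indicator : ∀ {Q : ℕ → Set} (Q? : Decidable Q) (k m : ℕ) → prod (λ n → k ^ indicator (Q? n)) m ≡ k ^ count Q? (downFrom m)
prod-pow-indicator Q? k zero = refl
prod-pow-indicator Q? k (suc m) =
  trans (cong (k ^ indicator (Q? m) *_) (prod-pow-indicator Q? k m)) (sym (^-distribˡ-+-* k (indicator (Q? m)) (count Q? (downFrom m))))

is-nothing? : (m : Maybe X) → Dec (m ≡ nothing)
is-nothing? nothing = yes refl
is-nothing? (just _) = no λ ()

module _ (f : Y → Maybe X) where

  length-mapMaybe≡count : ∀ {H : Y → Set} (H? : Decidable H) rs →
    (∀ {r} → r ∈ rs → H r → f r ≢ nothing) → (∀ {r} → r ∈ rs → ¬ H r → f r ≡ nothing) →
    length (mapMaybe f rs) ≡ count H? rs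
  length-mapMaybe≡count H? [] _ _ = refl
  length-mapMaybe≡count H? (r ∷ rs) defined undefined with f r in eq | H? r
  ... | just _ | yes _ = cong suc (length-mapMaybe≡count H? rs (defined ∘ there) (undefined ∘ there))
  ... | just _ | no ¬h = case trans (sym eq) (undefined (here refl) ¬h) of λ ()
  ... | nothing | yes h = ⊥-elim (defined (here refl) h eq)
  ... | nothing | no _ = length-mapMaybe≡count H? rs (defined ∘ there) (undefined ∘ there)

  ∈-mapMaybe⁻ : ∀ rs {y} → y ∈ mapMaybe f rs → Σ Y (λ r → r ∈ rs × f r ≡ just y)
  ∈-mapMaybe⁻ (r ∷ rs) y∈ with f r in eq
  ∈-mapMaybe⁻ (r ∷ rs) (here refl) | just _ = r , here refl , eq
  ∈-mapMaybe⁻ (r ∷ rs) (there y∈) | just _ = let (s , s∈rs , e) = ∈-mapMaybe⁻ rs y∈ in s , there s∈rs , e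
  ∈-mapMaybe⁻ (r ∷ rs) y∈ | nothing = let (s , s∈rs , e) = ∈-mapMaybe⁻ rs y∈ in s , there s∈rs , e

  mapMaybe-unique : ∀ {rs} → Unique rs → (∀ {r s y} → f r ≡ just y → f s ≡ just y → r ≡ s) → Unique (mapMaybe f rs)
  mapMaybe-unique {[]} _ _ = []
  mapMaybe-unique {r ∷ rs} (r∉rs ∷ u) inj with f r in eq
  ... | nothing = mapMaybe-unique u inj
  ... | just a = All.tabulate fresh ∷ mapMaybe-unique u inj
    where
    fresh : ∀ {y} → y ∈ mapMaybe f rs → a ≢ y
    fresh y∈ refl = let (s , s∈rs , e) = ∈-mapMaybe⁻ rs y∈ in All.lookup r∉rs s∈rs (inj eq e)

All-at-tail : ∀ {n} (Q : ℕ → Maybe X → Set) {x : X} {v : Vec X n} →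
  All (λ r → Q r (at (x ∷ v) r)) (downFrom (suc n)) → All (λ r → Q r (at v r)) (downFrom n)
All-at-tail Q {x} {v} (_ ∷ qs) = All.tabulate (λ {r} r∈ → subst (Q r) (at-old x v (<⇒≢ (∈-downFrom⁻ r∈))) (All.lookup qs r∈))

-- Extending a partial injection

factorIf : {P : Set} → Dec P → ℕ → ℕ
factorIf (yes _) w = w
factorIf (no _) _ = 1

prod-factorIf≡! : ∀ {H : ℕ → Set} (H? : Decidable H) N m → count H? (downFrom m) ≤ N →
  prod (λ n → factorIf (H? n) (N ∸ count H? (downFrom n))) m * (N ∸ count H? (downFrom m)) ! ≡ N !
prod-factorIf≡! H? N zero _ = *-identityˡ (N !)
prod-factorIf≡! H? N (suc m) h≤N with H? m
... | no _ = trans (cong (_* (N ∸ h) !) (+-identityʳ p)) (prod-factorIf≡! H? N m h≤N)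
  where
  h = count H? (downFrom m)
  p = prod (λ n → factorIf (H? n) (N ∸ count H? (downFrom n))) m
... | yes _ = begin
  (N ∸ h) * p * (N ∸ suc h) !   ≡⟨ cong (_* (N ∸ suc h) !) (*-comm (N ∸ h) p) ⟩
  p * (N ∸ h) * (N ∸ suc h) !   ≡⟨ *-assoc p (N ∸ h) ((N ∸ suc h) !) ⟩
  p * ((N ∸ h) * (N ∸ suc h) !) ≡⟨ cong (p *_) ([m∸n]!≡[m∸n]*[m∸1+n]! h≤N) ⟨
  p * (N ∸ h) !                 ≡⟨ prod-factorIf≡! H? N m (<⇒≤ h≤N) ⟩
  N !                           ∎
  where
  open ≡-Reasoning
  h = count H? (downFrom m)
  p = prod (λ n → factorIf (H? n) (N ∸ count H? (downFrom n))) m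

-- Permutations extending a partial injection g are counted position by position: a hole of g takes a
-- value outside the values of g and outside the values placed in earlier holes, so the holes of g admit
-- at most (number of holes)! fillings.
module Extensions (k : ℕ) (g : Vec (Maybe (Fin k)) k) where

  open import Data.List.Membership.DecPropositional (_≟ᶠ_ {k}) using (_∈?_)

  hole? : Decidable (λ r → atM g r ≡ nothing)
  hole? r = is-nothing? (atM g r)

  holes : ℕ → ℕ
  holes n = count hole? (downFrom n)

  values : List (Fin k)
  values = mapMaybe (atM g) (downFrom k)

  length-values+holes : length values + holes k ≡ k
  length-values+holes = begin
    length values + holes k
      ≡⟨ cong (_+ holes k) (length-mapMaybe≡count (atM g) (¬? ∘ hole?) (downFrom k) (λ _ → id) (λ _ → decidable-stable (hole? _))) ⟩
    count (¬? ∘ hole?) (downFrom k) + holes k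
      ≡⟨ +-comm _ (holes k) ⟩
    holes k + count (¬? ∘ hole?) (downFrom k)
      ≡⟨ count+count-¬≡length hole? (downFrom k) ⟩
    length (downFrom k)
      ≡⟨ length-downFrom k ⟩
    k ∎
    where open ≡-Reasoning

  Agrees : ℕ → Maybe (Fin k) → Set
  Agrees r m = atM g r ≡ nothing ⊎ atM g r ≡ m

  Avoids : ℕ → Maybe (Fin k) → Set
  Avoids r m = atM g r ≡ nothing → All (λ y → m ≢ just y) values

  -- Avoids is automatic for complete extensions (extends⇒prefix) but needed to count the choices at a hole
  Prefix : (n : ℕ) → Vec (Fin k) n → Set
  Prefix n v = Unique (toList v) × All (λ r → Agrees r (at v r)) (downFrom n) × All (λ r → Avoids r (at v r)) (downFrom n)

  prefix? : ∀ n → Decidable (Prefix n)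
  prefix? n v = unique? (toList v)
    ×-dec (All.all? (λ r → hole? r ⊎-dec Maybe.≡-dec _≟ᶠ_ (atM g r) (at v r)) (downFrom n)
    ×-dec All.all? (λ r → hole? r →-dec All.all? (λ y → ¬? (Maybe.≡-dec _≟ᶠ_ (at v r) (just y))) values) (downFrom n))

  Extends : Vec (Fin k) k → Set
  Extends π = Unique (toList π) × All (λ r → Agrees r (at π r)) (downFrom k)

  extends? : Decidable Extends
  extends? π = unique? (toList π) ×-dec All.all? (λ r → hole? r ⊎-dec Maybe.≡-dec _≟ᶠ_ (atM g r) (at π r)) (downFrom k)

  prefix-tail : ∀ n x v → Prefix (suc n) (x ∷ v) → Prefix n v
  prefix-tail n x v (_ ∷ u , agree , avoid) = u , All-at-tail Agrees agree , All-at-tail Avoids avoid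

  InjectiveWhereDefined : Set
  InjectiveWhereDefined = ∀ {r s a} → atM g r ≡ just a → atM g s ≡ just a → r ≡ s

  module _ (g-injective : InjectiveWhereDefined) (n : ℕ) (v : Vec (Fin k) n) (prefix : Prefix n v) where

    private
      v-unique = proj₁ prefix
      v-avoids = proj₂ (proj₂ prefix)

    extension-at-value : atM g n ≢ nothing → extensions (allFin k) Prefix prefix? v ≤ 1
    extension-at-value defined =
      count≤1 (λ x → prefix? (suc n) (x ∷ v)) (Unique.allFin⁺ k) (λ p q → Maybe.just-injective (trans (sym (forced p)) (forced q)))
      where
      forced : ∀ {x} → Prefix (suc n) (x ∷ v) → atM g n ≡ just x
      forced (_ , inj₁ hole ∷ _ , _) = ⊥-elim (defined hole)
      forced {x} (_ , inj₂ e ∷ _ , _) = trans e (at-new x v)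

    filled : ℕ → Maybe (Fin k)
    filled r with hole? r
    ... | yes _ = at v r
    ... | no _ = nothing

    filled-just : ∀ {r y} → filled r ≡ just y → atM g r ≡ nothing × at v r ≡ just y
    filled-just {r} e with hole? r
    ... | yes hole = hole , e

    used : List (Fin k)
    used = values ++ mapMaybe filled (downFrom n)

    used-unique : Unique used
    used-unique = Unique.++⁺ (mapMaybe-unique (atM g) (Unique.downFrom⁺ k) g-injective)
                      (mapMaybe-unique filled (Unique.downFrom⁺ n) filled-injective) disjoint
      where
      filled-injective : ∀ {r s y} → filled r ≡ just y → filled s ≡ just y → r ≡ s
      filled-injective e₁ e₂ = at-injective v v-unique _ _ (proj₂ (filled-just e₁)) (proj₂ (filled-just e₂))
      disjoint : ∀ {y} → ¬ (y ∈ values × y ∈ mapMaybe filled (downFrom n))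
      disjoint (y∈values , y∈filled) with ∈-mapMaybe⁻ filled (downFrom n) y∈filled
      ... | r , r∈ , e = let (hole , e′) = filled-just e in All.lookup (All.lookup v-avoids r∈ hole) y∈values e′

    length-used : length used ≡ length values + holes n
    length-used = trans (length-++ values) (cong (length values +_)
      (length-mapMaybe≡count filled hole? (downFrom n) defined undefined))
      where
      defined : ∀ {r} → r ∈ downFrom n → atM g r ≡ nothing → filled r ≢ nothing
      defined {r} r∈ hole e with hole? r | at-in v (∈-downFrom⁻ r∈)
      ... | yes _ | _ , e′ = case trans (sym e′) e of λ ()
      ... | no ¬hole | _ = ¬hole hole
      undefined : ∀ {r} → r ∈ downFrom n → atM g r ≢ nothing → filled r ≡ nothing
      undefined {r} _ ¬hole with hole? r
      ... | yes hole = ⊥-elim (¬hole hole)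
      ... | no _ = refl

    fresh : ∀ {x} → atM g n ≡ nothing → Prefix (suc n) (x ∷ v) → x ∉ used
    fresh hole (x∉v ∷ _ , _ , avoid-x ∷ _) x∈used with ∈-++⁻ values x∈used
    ... | inj₁ x∈values = All.lookup (avoid-x hole) x∈values (at-new _ v)
    ... | inj₂ x∈filled with ∈-mapMaybe⁻ filled (downFrom n) x∈filled
    ... | r , _ , e = All.lookup x∉v (at-∈ v r (proj₂ (filled-just e))) refl

    extension-at-hole : atM g n ≡ nothing → extensions (allFin k) Prefix prefix? v ≤ holes k ∸ holes n
    extension-at-hole hole = begin
      count (λ x → prefix? (suc n) (x ∷ v)) (allFin k) ≤⟨ count-mono _ (λ x → ¬? (x ∈? used)) (allFin k) (λ _ → fresh hole) ⟩
      count (λ x → ¬? (x ∈? used)) (allFin k)          ≡⟨ count-∉-allFin used-unique ⟩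
      k ∸ length used                                  ≡⟨ cong₂ _∸_ (sym length-values+holes) length-used ⟩
      (length values + holes k) ∸ (length values + holes n) ≡⟨ [m+n]∸[m+o]≡n∸o (length values) (holes k) (holes n) ⟩
      holes k ∸ holes n                                ∎
      where open ≤-Reasoning

  extension-bound : InjectiveWhereDefined → ∀ n v → Prefix n v →
                    extensions (allFin k) Prefix prefix? v ≤ factorIf (hole? n) (holes k ∸ holes n)
  extension-bound g-injective n v p = bound (hole? n)
    where
    bound : (h : Dec (atM g n ≡ nothing)) → extensions (allFin k) Prefix prefix? v ≤ factorIf h (holes k ∸ holes n)
    bound (yes hole) = extension-at-hole g-injective n v p hole
    bound (no defined) = extension-at-value g-injective n v p defined

  extends⇒prefix : ∀ {π} → Extends π → Prefix k π
  extends⇒prefix {π} (u , agree) = u , agree , All.tabulate avoids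
    where
    avoids : ∀ {r} → r ∈ downFrom k → Avoids r (at π r)
    avoids {r} _ hole = All.tabulate λ {y} y∈values πr≡y → case ∈-mapMaybe⁻ (atM g) (downFrom k) y∈values of λ where
      (s , s∈ , gs≡y) → case All.lookup agree s∈ of λ where
        (inj₁ s-hole) → case trans (sym gs≡y) s-hole of λ ()
        (inj₂ gs≡πs) → case at-injective π u r s πr≡y (trans (sym gs≡πs) gs≡y) of λ where
          refl → case trans (sym gs≡y) hole of λ ()

  count-extends≤! : InjectiveWhereDefined → count extends? (allVecsOf (allFin k) k) ≤ holes k !
  count-extends≤! g-injective = begin
    count extends? (allVecsOf (allFin k) k)
      ≤⟨ count-mono extends? (prefix? k) (allVecsOf (allFin k) k) (λ _ → extends⇒prefix) ⟩
    count (prefix? k) (allVecsOf (allFin k) k)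
      ≤⟨ count-allVecsOf≤prod (allFin k) Prefix prefix? c prefix-tail (extension-bound g-injective) k ⟩
    prod c k
      ≡⟨ *-identityʳ (prod c k) ⟨
    prod c k * 0 !
      ≡⟨ cong (λ m → prod c k * m !) (n∸n≡0 (holes k)) ⟨
    prod c k * (holes k ∸ holes k) !
      ≡⟨ prod-factorIf≡! hole? (holes k) k ≤-refl ⟩
    holes k ! ∎
    where
    open ≤-Reasoning
    c : ℕ → ℕ
    c n = factorIf (hole? n) (holes k ∸ holes n)

-- Permutations satisfying shift constraints

[k∸u]!*[k∸m]^u≤k! : ∀ k m u → u ≤ m → m ≤ k → (k ∸ u) ! * (k ∸ m) ^ u ≤ k !
[k∸u]!*[k∸m]^u≤k! k m zero _ _ = ≤-reflexive (*-identityʳ (k !))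
[k∸u]!*[k∸m]^u≤k! k m (suc u) u<m m≤k = begin
  (k ∸ suc u) ! * ((k ∸ m) * (k ∸ m) ^ u)
    ≡⟨ *-assoc ((k ∸ suc u) !) (k ∸ m) _ ⟨
  (k ∸ suc u) ! * (k ∸ m) * (k ∸ m) ^ u
    ≤⟨ *-monoˡ-≤ ((k ∸ m) ^ u) (*-monoʳ-≤ ((k ∸ suc u) !) (∸-monoʳ-≤ k (<⇒≤ u<m))) ⟩
  (k ∸ suc u) ! * (k ∸ u) * (k ∸ m) ^ u
    ≡⟨ cong (_* (k ∸ m) ^ u) (trans (*-comm ((k ∸ suc u) !) (k ∸ u)) (sym ([m∸n]!≡[m∸n]*[m∸1+n]! (≤-trans u<m m≤k)))) ⟩
  (k ∸ u) ! * (k ∸ m) ^ u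
    ≤⟨ [k∸u]!*[k∸m]^u≤k! k m u (<⇒≤ u<m) m≤k ⟩
  k ! ∎
  where open ≤-Reasoning

k^F*[k∸u]!*[k∸2L]^2L≤k^L*k! : ∀ k F u L → 1 ≤ k → F + L ≤ u → u ≤ L + L → L + L ≤ k →
                              k ^ F * (k ∸ u) ! * (k ∸ (L + L)) ^ (L + L) ≤ k ^ L * k !
k^F*[k∸u]!*[k∸2L]^2L≤k^L*k! k F u L 1≤k F+L≤u u≤2L 2L≤k = begin
  k ^ F * (k ∸ u) ! * d ^ (L + L)
    ≡⟨ cong (λ e → k ^ F * (k ∸ u) ! * d ^ e) (m+[n∸m]≡n u≤2L) ⟨
  k ^ F * (k ∸ u) ! * d ^ (u + (L + L ∸ u))
    ≡⟨ cong (k ^ F * (k ∸ u) ! *_) (^-distribˡ-+-* d u (L + L ∸ u)) ⟩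
  k ^ F * (k ∸ u) ! * (d ^ u * d ^ (L + L ∸ u))
    ≡⟨ solve 4 (λ a b c e → a :* b :* (c :* e) := (b :* c) :* (a :* e)) refl (k ^ F) ((k ∸ u) !) (d ^ u) (d ^ (L + L ∸ u)) ⟩
  ((k ∸ u) ! * d ^ u) * (k ^ F * d ^ (L + L ∸ u))
    ≤⟨ *-mono-≤ ([k∸u]!*[k∸m]^u≤k! k (L + L) u u≤2L 2L≤k) (*-monoʳ-≤ (k ^ F) (^-monoˡ-≤ (L + L ∸ u) (m∸n≤m k (L + L)))) ⟩
  k ! * (k ^ F * k ^ (L + L ∸ u))
    ≡⟨ cong (k ! *_) (^-distribˡ-+-* k F (L + L ∸ u)) ⟨
  k ! * k ^ (F + (L + L ∸ u))
    ≤⟨ *-monoʳ-≤ (k !) (^-monoʳ-≤ k {{>-nonZero 1≤k}} exponent) ⟩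
  k ! * k ^ L
    ≡⟨ *-comm (k !) (k ^ L) ⟩
  k ^ L * k ! ∎
  where
  open ≤-Reasoning
  d = k ∸ (L + L)
  exponent : F + (L + L ∸ u) ≤ L
  exponent = +-cancelʳ-≤ u _ _ (begin
    F + (L + L ∸ u) + u   ≡⟨ +-assoc F (L + L ∸ u) u ⟩
    F + (L + L ∸ u + u)   ≡⟨ cong (F +_) (m∸n+n≡m u≤2L) ⟩
    F + (L + L)           ≡⟨ +-assoc F L L ⟨
    F + L + L             ≤⟨ +-monoˡ-≤ L F+L≤u ⟩
    u + L                 ≡⟨ +-comm u L ⟩
    L + u                 ∎)

keepIf : ∀ {P : Set} → Dec P → Maybe X → Maybe X
keepIf (yes _) m = m
keepIf (no _) _ = nothing

keepIf-yes : ∀ {P : Set} (d : Dec P) → P → (m : Maybe X) → keepIf d m ≡ m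
keepIf-yes (yes _) _ m = refl
keepIf-yes (no ¬p) p _ = ⊥-elim (¬p p)

-- Constraints "value at r = value at s + Δ" on a permutation vector, for a list ps of pairs (r , s) of
-- positions (counted from the end) whose coordinates both decrease along the list. Such a permutation
-- is an extension of its restriction to the domain of ps, a pattern; in a pattern each pair determines the
-- value at its larger position from the one at its smaller position, and the larger positions are distinct.
module ShiftCount (k Δ′ : ℕ) (ps : List (ℕ × ℕ))
  (ps<k : All (λ p → proj₁ p < k × proj₂ p < k) ps)
  (decreasing : AllPairs (λ p q → proj₁ q < proj₁ p × proj₂ q < proj₂ p) ps) where

  open import Data.List.Membership.DecPropositional _≟_ using (_∈?_)

  Δ : ℕ
  Δ = suc Δ′

  Related : Maybe (Fin k) → Maybe (Fin k) → Set
  Related (just a) (just b) = toℕ a ≡ toℕ b + Δ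
  Related _ _ = ⊥

  related? : ∀ m m′ → Dec (Related m m′)
  related? (just a) (just b) = toℕ a ≟ toℕ b + Δ
  related? (just _) nothing = no λ ()
  related? nothing _ = no λ ()

  Related-injectiveˡ : ∀ {m m′ w} → Related m w → Related m′ w → m ≡ m′
  Related-injectiveˡ {just a} {just a′} {just b} e e′ = cong just (toℕ-injective (trans e (sym e′)))

  Related-injectiveʳ : ∀ {w m m′} → Related w m → Related w m′ → m ≡ m′
  Related-injectiveʳ {just b} {just a} {just a′} e e′ = cong just (toℕ-injective (+-cancelʳ-≡ Δ (toℕ a) (toℕ a′) (trans (sym e) e′)))

  Related-irreflexive : ∀ {m} → ¬ Related m m
  Related-irreflexive {just a} e = m+1+n≢m (toℕ a) (sym e)

  L : ℕ
  L = length ps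

  domain : List ℕ
  domain = map proj₁ ps ++ map proj₂ ps

  tops : List ℕ
  tops = map (λ p → proj₁ p ⊔ proj₂ p) ps

  free? : Decidable (λ r → r ∈ domain × r ∉ tops)
  free? r = r ∈? domain ×-dec ¬? (r ∈? tops)

  u : ℕ
  u = count (_∈? domain) (downFrom k)

  F : ℕ
  F = count free? (downFrom k)

  ShapedAt : ℕ → Maybe (Fin k) → Set
  ShapedAt r m = (r ∈ domain → m ≢ nothing) × (r ∉ domain → m ≡ nothing)

  Constrained : ∀ {n} → Vec (Maybe (Fin k)) n → Set
  Constrained {n} g = All (λ p → proj₁ p < n → proj₂ p < n → Related (atM g (proj₁ p)) (atM g (proj₂ p))) ps

  Pattern : (n : ℕ) → Vec (Maybe (Fin k)) n → Set
  Pattern n g = All (λ r → ShapedAt r (atM g r)) (downFrom n) × Constrained g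

  pattern? : ∀ n → Decidable (Pattern n)
  pattern? n g =
    All.all? (λ r → ((r ∈? domain) →-dec ¬? (is-nothing? (atM g r))) ×-dec (¬? (r ∈? domain) →-dec is-nothing? (atM g r))) (downFrom n)
    ×-dec All.all? (λ p → (proj₁ p <? n) →-dec ((proj₂ p <? n) →-dec related? (atM g (proj₁ p)) (atM g (proj₂ p)))) ps

  pattern-tail : ∀ n m g → Pattern (suc n) (m ∷ g) → Pattern n g
  pattern-tail n m g (shaped , constrained) =
    All-at-tail (λ r m → ShapedAt r (m >>= id)) shaped ,
    All.map (λ c p₁<n p₂<n → subst₂ Related (atM-old m g (<⇒≢ p₁<n)) (atM-old m g (<⇒≢ p₂<n))
                                     (c (m≤n⇒m≤1+n p₁<n) (m≤n⇒m≤1+n p₂<n))) constrained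

  allMaybeFin : List (Maybe (Fin k))
  allMaybeFin = nothing ∷ map just (allFin k)

  ∈-allMaybeFin : ∀ m → m ∈ allMaybeFin
  ∈-allMaybeFin nothing = here refl
  ∈-allMaybeFin (just a) = there (∈-map⁺ just (∈-allFin a))

  allMaybeFin-unique : Unique allMaybeFin
  allMaybeFin-unique = All.tabulate nothing∉ ∷ Unique.map⁺ Maybe.just-injective (Unique.allFin⁺ k)
    where
    nothing∉ : ∀ {m} → m ∈ map just (allFin k) → nothing ≢ m
    nothing∉ m∈ refl with ∈-map⁻ just m∈
    ... | _ , _ , ()

  -- off the domain the entry is nothing, at the larger position of a pair it is forced by the partner
  pattern-extensions : ∀ n g → Pattern n g → extensions allMaybeFin Pattern pattern? g ≤ k ^ indicator (free? n)
  pattern-extensions n g _ = bound (n ∈? domain) (n ∈? tops)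
    where
    P? : Decidable (λ m → Pattern (suc n) (m ∷ g))
    P? m = pattern? (suc n) (m ∷ g)

    bound : (d : Dec (n ∈ domain)) (t : Dec (n ∈ tops)) → count P? allMaybeFin ≤ k ^ indicator (d ×-dec ¬? t)
    bound (no n∉domain) _ = count≤1 P? allMaybeFin-unique λ p q → trans (undefined p) (sym (undefined q))
      where
      undefined : ∀ {m} → Pattern (suc n) (m ∷ g) → m ≡ nothing
      undefined {m} ((_ , off-domain) ∷ _ , _) = trans (sym (atM-new m g)) (off-domain n∉domain)
    bound (yes n∈domain) (no _) with P? nothing
    ... | yes ((on-domain , _) ∷ _ , _) = ⊥-elim (on-domain n∈domain (atM-new nothing g))
    ... | no _ = ≤-trans (count≤length P? (map just (allFin k)))
                         (≤-reflexive (trans (length-map just (allFin k)) (trans (length-allFin k) (sym (*-identityʳ k)))))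
    bound (yes _) (yes n∈tops) with ∈-map⁻ (λ p → proj₁ p ⊔ proj₂ p) n∈tops
    ... | (r , s) , p∈ps , n≡r⊔s = count≤1 P? allMaybeFin-unique determined
      where
      r<1+n : r < suc n
      r<1+n = s≤s (subst (r ≤_) (sym n≡r⊔s) (m≤m⊔n r s))
      s<1+n : s < suc n
      s<1+n = s≤s (subst (s ≤_) (sym n≡r⊔s) (m≤n⊔m r s))
      constraint : ∀ {m} → Pattern (suc n) (m ∷ g) → Related (atM (m ∷ g) r) (atM (m ∷ g) s)
      constraint (_ , c) = All.lookup c p∈ps r<1+n s<1+n
      determined : ∀ {a b} → Pattern (suc n) (a ∷ g) → Pattern (suc n) (b ∷ g) → a ≡ b
      determined {a} {b} pa pb with r ≟ n | s ≟ n
      ... | yes refl | yes refl = ⊥-elim (Related-irreflexive (subst (λ z → Related z z) (atM-new a g) (constraint pa)))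
      ... | yes refl | no s≢n = Related-injectiveˡ (subst₂ Related (atM-new a g) (atM-old a g s≢n) (constraint pa))
                                                   (subst₂ Related (atM-new b g) (atM-old b g s≢n) (constraint pb))
      ... | no r≢n | yes refl = Related-injectiveʳ (subst₂ Related (atM-old a g r≢n) (atM-new a g) (constraint pa))
                                                   (subst₂ Related (atM-old b g r≢n) (atM-new b g) (constraint pb))
      ... | no r≢n | no s≢n = case ⊔-sel r s of λ where
        (inj₁ r⊔s≡r) → ⊥-elim (r≢n (sym (trans n≡r⊔s r⊔s≡r)))
        (inj₂ r⊔s≡s) → ⊥-elim (s≢n (sym (trans n≡r⊔s r⊔s≡s)))

  count-patterns : count (pattern? k) (allVecsOf allMaybeFin k) ≤ k ^ F
  count-patterns = ≤-trans (count-allVecsOf≤prod allMaybeFin Pattern pattern? (λ n → k ^ indicator (free? n)) pattern-tail pattern-extensions k)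
                           (≤-reflexive (prod-pow-indicator free? k k))

  Satisfies : Vec (Fin k) k → Set
  Satisfies π = All (λ p → Related (at π (proj₁ p)) (at π (proj₂ p))) ps

  satisfies? : Decidable Satisfies
  satisfies? π = All.all? (λ p → related? (at π (proj₁ p)) (at π (proj₂ p))) ps

  InjectiveOnDomain : Vec (Maybe (Fin k)) k → Set
  InjectiveOnDomain g = All (λ r → All (λ s → atM g r ≡ atM g s → atM g r ≡ nothing ⊎ r ≡ s) (downFrom k)) (downFrom k)

  injectiveOnDomain? : Decidable InjectiveOnDomain
  injectiveOnDomain? g = All.all? (λ r → All.all? (λ s →
    Maybe.≡-dec _≟ᶠ_ (atM g r) (atM g s) →-dec (is-nothing? (atM g r) ⊎-dec r ≟ s)) (downFrom k)) (downFrom k)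

  injective-where-defined : ∀ {g} → InjectiveOnDomain g → Extensions.InjectiveWhereDefined k g
  injective-where-defined {g} inj {r} {s} gr≡a gs≡a
    with All.lookup (All.lookup inj (∈-downFrom⁺ (atM-just⇒< g r gr≡a))) (∈-downFrom⁺ (atM-just⇒< g s gs≡a)) (trans gr≡a (sym gs≡a))
  ... | inj₁ gr≡nothing = case trans (sym gr≡a) gr≡nothing of λ ()
  ... | inj₂ r≡s = r≡s

  ValidPattern : Vec (Maybe (Fin k)) k → Set
  ValidPattern g = Pattern k g × InjectiveOnDomain g

  validPattern? : Decidable ValidPattern
  validPattern? g = pattern? k g ×-dec injectiveOnDomain? g

  restrict : ∀ {n} → Vec (Fin k) n → Vec (Maybe (Fin k)) n
  restrict [] = []
  restrict (_∷_ {n} x v) = keepIf (n ∈? domain) (just x) ∷ restrict v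

  atM-restrict : ∀ {n} (v : Vec (Fin k) n) r → atM (restrict v) r ≡ keepIf (r ∈? domain) (at v r)
  atM-restrict [] r with r ∈? domain
  ... | yes _ = refl
  ... | no _ = refl
  atM-restrict (_∷_ {n} x v) r with r ≟ n
  ... | yes refl = refl
  ... | no _ = atM-restrict v r

  module _ {π : Vec (Fin k) k} (π-unique : Unique (toList π)) where

    restrict-injective : InjectiveOnDomain (restrict π)
    restrict-injective = All.tabulate λ {r} r∈ → All.tabulate λ {s} s∈ → injective r s (∈-downFrom⁻ r∈) (∈-downFrom⁻ s∈)
      where
      injective : ∀ r s → r < k → s < k → atM (restrict π) r ≡ atM (restrict π) s → atM (restrict π) r ≡ nothing ⊎ r ≡ s
      injective r s r<k s<k e rewrite atM-restrict π r | atM-restrict π s with r ∈? domain | s ∈? domain | at-in π r<k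
      ... | no _ | _ | _ = inj₁ refl
      ... | yes _ | no _ | _ , πr≡a = case trans (sym πr≡a) e of λ ()
      ... | yes _ | yes _ | _ , πr≡a = inj₂ (at-injective π π-unique r s πr≡a (trans (sym e) πr≡a))

    restrict-pattern : Satisfies π → Pattern k (restrict π)
    restrict-pattern sat = All.tabulate shaped , All.tabulate constrained
      where
      shaped : ∀ {r} → r ∈ downFrom k → ShapedAt r (atM (restrict π) r)
      shaped {r} r∈ rewrite atM-restrict π r with r ∈? domain | at-in π (∈-downFrom⁻ r∈)
      ... | yes r∈d | _ , πr≡a = (λ _ e → case trans (sym πr≡a) e of λ ()) , (λ r∉d → ⊥-elim (r∉d r∈d))
      ... | no r∉d | _ = (λ r∈d _ → r∉d r∈d) , λ _ → refl
      constrained : ∀ {p} → p ∈ ps → _ → _ → Related (atM (restrict π) (proj₁ p)) (atM (restrict π) (proj₂ p))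
      constrained {p} p∈ _ _ rewrite atM-restrict π (proj₁ p) | atM-restrict π (proj₂ p)
        | keepIf-yes (proj₁ p ∈? domain) (∈-++⁺ˡ (∈-map⁺ proj₁ p∈)) (at π (proj₁ p))
        | keepIf-yes (proj₂ p ∈? domain) (∈-++⁺ʳ (map proj₁ ps) (∈-map⁺ proj₂ p∈)) (at π (proj₂ p)) = All.lookup sat p∈

    extends-restrict : Extensions.Extends k (restrict π) π
    extends-restrict = π-unique , All.tabulate agrees
      where
      agrees : ∀ {r} → r ∈ downFrom k → Extensions.Agrees k (restrict π) r (at π r)
      agrees {r} _ rewrite atM-restrict π r with r ∈? domain
      ... | yes _ = inj₂ refl
      ... | no _ = inj₁ refl

  holes-valid : ∀ {g} → ValidPattern g → Extensions.holes k g k ≡ k ∸ u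
  holes-valid {g} ((shaped , _) , _) = begin
    count (λ r → is-nothing? (atM g r)) (downFrom k)
      ≡⟨ count-cong _ (¬? ∘ (_∈? domain)) (downFrom k) off-domain on-domain ⟩
    count (¬? ∘ (_∈? domain)) (downFrom k)
      ≡⟨ m+n∸m≡n u _ ⟨
    u + count (¬? ∘ (_∈? domain)) (downFrom k) ∸ u
      ≡⟨ cong (_∸ u) (trans (count+count-¬≡length (_∈? domain) (downFrom k)) (length-downFrom k)) ⟩
    k ∸ u ∎
    where
    open ≡-Reasoning
    off-domain : ∀ {r} → r ∈ downFrom k → atM g r ≡ nothing → r ∉ domain
    off-domain r∈ hole r∈d = proj₁ (All.lookup shaped r∈) r∈d hole
    on-domain : ∀ {r} → r ∈ downFrom k → r ∉ domain → atM g r ≡ nothing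
    on-domain r∈ r∉d = proj₂ (All.lookup shaped r∈) r∉d

  count-satisfying : count (λ π → unique? (toList π) ×-dec satisfies? π) (allVecsOf (allFin k) k) ≤ k ^ F * (k ∸ u) !
  count-satisfying = begin
    count (λ π → unique? (toList π) ×-dec satisfies? π) perms
      ≤⟨ count≤sum-count (λ π → unique? (toList π) ×-dec satisfies? π) witnessed? patterns witness perms ⟩
    sum (map (λ g → count (witnessed? g) perms) patterns)
      ≤⟨ sum-map≤count* validPattern? (λ g → count (witnessed? g) perms) ((k ∸ u) !) (λ {g} → extensions-of-valid {g}) (λ {g} → no-witness {g}) patterns ⟩
    count validPattern? patterns * (k ∸ u) !
      ≤⟨ *-monoˡ-≤ ((k ∸ u) !) (count-mono validPattern? (pattern? k) patterns (λ _ → proj₁)) ⟩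
    count (pattern? k) patterns * (k ∸ u) !
      ≤⟨ *-monoˡ-≤ ((k ∸ u) !) count-patterns ⟩
    k ^ F * (k ∸ u) ! ∎
    where
    open ≤-Reasoning
    perms = allVecsOf (allFin k) k
    patterns = allVecsOf allMaybeFin k
    witnessed? : ∀ g → Decidable (λ π → ValidPattern g × Extensions.Extends k g π)
    witnessed? g π = validPattern? g ×-dec Extensions.extends? k g π
    witness : ∀ {π} → Unique (toList π) × Satisfies π → Σ _ (λ g → g ∈ patterns × ValidPattern g × Extensions.Extends k g π)
    witness {π} (π-unique , sat) = restrict π , ∈-allVecsOf (restrict π) (∈-allMaybeFin _) ,
      (restrict-pattern π-unique sat , restrict-injective π-unique) , extends-restrict π-unique
    no-witness : ∀ {g} → ¬ ValidPattern g → count (witnessed? g) perms ≡ 0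
    no-witness {g} ¬valid = count≡0 (witnessed? g) perms (λ _ w → ¬valid (proj₁ w))
    extensions-of-valid : ∀ {g} → ValidPattern g → count (witnessed? g) perms ≤ (k ∸ u) !
    extensions-of-valid {g} valid@(_ , inj) = begin
      count (witnessed? g) perms                 ≤⟨ count-mono (witnessed? g) (Extensions.extends? k g) perms (λ _ → proj₂) ⟩
      count (Extensions.extends? k g) perms      ≤⟨ Extensions.count-extends≤! k g (injective-where-defined {g} inj) ⟩
      Extensions.holes k g k !                   ≡⟨ cong _! (holes-valid {g} valid) ⟩
      (k ∸ u) !                                  ∎

  tops-unique : Unique tops
  tops-unique = AllPairs.map⁺ (AllPairs.map (λ (r′<r , s′<s) e → <-irrefl (sym e) (⊔-mono-< r′<r s′<s)) decreasing)

  L≤count-domain-tops : L ≤ count (λ r → r ∈? domain ×-dec r ∈? tops) (downFrom k)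
  L≤count-domain-tops = begin
    L
      ≡⟨ length-map _ ps ⟨
    length tops
      ≤⟨ length≤count-∈ _≟_ tops-unique (downFrom k) top<k ⟩
    count (_∈? tops) (downFrom k)
      ≤⟨ count-mono (_∈? tops) _ (downFrom k) (λ _ r∈tops → top∈domain r∈tops , r∈tops) ⟩
    count (λ r → r ∈? domain ×-dec r ∈? tops) (downFrom k) ∎
    where
    open ≤-Reasoning
    top<k : ∀ {r} → r ∈ tops → r ∈ downFrom k
    top<k r∈ with ∈-map⁻ _ r∈
    ... | p , p∈ , refl = ∈-downFrom⁺ (⊔-lub (proj₁ (All.lookup ps<k p∈)) (proj₂ (All.lookup ps<k p∈)))
    top∈domain : ∀ {r} → r ∈ tops → r ∈ domain
    top∈domain r∈ with ∈-map⁻ _ r∈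
    ... | p , p∈ , refl with ⊔-sel (proj₁ p) (proj₂ p)
    ... | inj₁ e = subst (_∈ domain) (sym e) (∈-++⁺ˡ (∈-map⁺ proj₁ p∈))
    ... | inj₂ e = subst (_∈ domain) (sym e) (∈-++⁺ʳ (map proj₁ ps) (∈-map⁺ proj₂ p∈))

  F+L≤u : F + L ≤ u
  F+L≤u = ≤-trans (+-monoʳ-≤ F L≤count-domain-tops) (≤-reflexive (sym (count-split (_∈? domain) (_∈? tops) (downFrom k))))

  u≤L+L : u ≤ L + L
  u≤L+L = begin
    u                     ≤⟨ count-∈≤length _≟_ (Unique.downFrom⁺ k) domain ⟩
    length domain         ≡⟨ length-++ (map proj₁ ps) ⟩
    length (map proj₁ ps) + length (map proj₂ ps) ≡⟨ cong₂ _+_ (length-map proj₁ ps) (length-map proj₂ ps) ⟩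
    L + L                 ∎
    where open ≤-Reasoning

  count-satisfying*[k∸2L]^2L≤k^L*k! : 1 ≤ k → L + L ≤ k →
    count (λ π → unique? (toList π) ×-dec satisfies? π) (allVecsOf (allFin k) k) * (k ∸ (L + L)) ^ (L + L) ≤ k ^ L * k !
  count-satisfying*[k∸2L]^2L≤k^L*k! 1≤k 2L≤k =
    ≤-trans (*-monoˡ-≤ ((k ∸ (L + L)) ^ (L + L)) count-satisfying) (k^F*[k∸u]!*[k∸2L]^2L≤k^L*k! k F u L 1≤k F+L≤u u≤L+L 2L≤k)

-- Subsets

card≡length-elems : ∀ {n} (p : Subset n) → ∣ p ∣ ≡ length (elems p)
card≡length-elems [] = refl
card≡length-elems (true ∷ p) = cong suc (trans (card≡length-elems p) (sym (length-map fsuc (elems p))))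
card≡length-elems (false ∷ p) = trans (card≡length-elems p) (sym (length-map fsuc (elems p)))

elems-increasing : ∀ {n} (p : Subset n) → AllPairs (λ a b → toℕ a < toℕ b) (elems p)
elems-increasing [] = []
elems-increasing (true ∷ p) = All.tabulate 0<suc ∷ AllPairs.map⁺ (AllPairs.map s≤s (elems-increasing p))
  where
  0<suc : ∀ {x} → x ∈ map fsuc (elems p) → 0 < toℕ x
  0<suc x∈ with ∈-map⁻ fsuc x∈
  ... | _ , _ , refl = s≤s z≤n
elems-increasing (false ∷ p) = AllPairs.map⁺ (AllPairs.map s≤s (elems-increasing p))

takeSubset : ∀ {n} → ℕ → Subset n → Subset n
takeSubset L [] = []
takeSubset zero (_ ∷ p) = false ∷ takeSubset zero p
takeSubset (suc L) (true ∷ p) = true ∷ takeSubset L p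
takeSubset (suc L) (false ∷ p) = false ∷ takeSubset (suc L) p

elems-takeSubset : ∀ {n} L (p : Subset n) → elems (takeSubset L p) ≡ take L (elems p)
elems-takeSubset zero [] = refl
elems-takeSubset (suc L) [] = refl
elems-takeSubset zero (_ ∷ p) = cong (map fsuc) (elems-takeSubset zero p)
elems-takeSubset (suc L) (true ∷ p) = cong (fzero ∷_) (trans (cong (map fsuc) (elems-takeSubset L p)) (sym (take-map L (elems p))))
elems-takeSubset (suc L) (false ∷ p) = trans (cong (map fsuc) (elems-takeSubset (suc L) p)) (sym (take-map (suc L) (elems p)))

card-takeSubset : ∀ {n} L (p : Subset n) → L ≤ ∣ p ∣ → ∣ takeSubset L p ∣ ≡ L
card-takeSubset L p L≤∣p∣ = begin
  ∣ takeSubset L p ∣             ≡⟨ card≡length-elems (takeSubset L p) ⟩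
  length (elems (takeSubset L p)) ≡⟨ cong length (elems-takeSubset L p) ⟩
  length (take L (elems p))       ≡⟨ length-take L (elems p) ⟩
  L ⊓ length (elems p)            ≡⟨ m≤n⇒m⊓n≡m (subst (L ≤_) (card≡length-elems p) L≤∣p∣) ⟩
  L                               ∎
  where open ≡-Reasoning

Pointwise-take : ∀ {A B : Set} {R : A → B → Set} L {xs ys} → Pointwise R xs ys → Pointwise R (take L xs) (take L ys)
Pointwise-take zero _ = []
Pointwise-take (suc L) [] = []
Pointwise-take (suc L) (r ∷ rs) = r ∷ Pointwise-take L rs

IsShift-takeSubset : ∀ {k} {π : Fin k → Fin k} {Δ A B} L → IsShift π Δ A B → IsShift π Δ (takeSubset L A) (takeSubset L B)
IsShift-takeSubset {π = π} {Δ} {A} {B} L shift =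
  subst₂ (Pointwise _) (sym (elems-takeSubset L A)) (sym (elems-takeSubset L B)) (Pointwise-take L shift)

∈-allSubsets : ∀ {n} (p : Subset n) → p ∈ allSubsets n
∈-allSubsets p = ∈-allVecsOf p ∈-bools
  where
  ∈-bools : ∀ {b} → b ∈ true ∷ false ∷ []
  ∈-bools {true} = here refl
  ∈-bools {false} = there (here refl)

subsetsOfSize : ℕ → ℕ → ℕ
subsetsOfSize n L = count (λ A → ∣ A ∣ ≟ L) (allSubsets n)

subsetsOfSize-suc : ∀ n L → subsetsOfSize (suc n) L ≡ count (λ A → suc ∣ A ∣ ≟ L) (allSubsets n) + subsetsOfSize n L
subsetsOfSize-suc n L = begin
  subsetsOfSize (suc n) L
    ≡⟨ count-allVecsOf-suc (true ∷ false ∷ []) (λ _ A → ∣ A ∣ ≡ L) (λ _ A → ∣ A ∣ ≟ L) n ⟩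
  sum (map (λ A → indicator (suc ∣ A ∣ ≟ L) + (indicator (∣ A ∣ ≟ L) + 0)) (allSubsets n))
    ≡⟨ cong sum (map-cong (λ A → cong (indicator (suc ∣ A ∣ ≟ L) +_) (+-identityʳ _)) (allSubsets n)) ⟩
  sum (map (λ A → indicator (suc ∣ A ∣ ≟ L) + indicator (∣ A ∣ ≟ L)) (allSubsets n))
    ≡⟨ sum-map-+ (λ A → indicator (suc ∣ A ∣ ≟ L)) (λ A → indicator (∣ A ∣ ≟ L)) (allSubsets n) ⟩
  sum (map (λ A → indicator (suc ∣ A ∣ ≟ L)) (allSubsets n)) + sum (map (λ A → indicator (∣ A ∣ ≟ L)) (allSubsets n))
    ≡⟨ cong₂ _+_ (count≡sum-indicator (λ A → suc ∣ A ∣ ≟ L) (allSubsets n)) (count≡sum-indicator (λ A → ∣ A ∣ ≟ L) (allSubsets n)) ⟨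
  count (λ A → suc ∣ A ∣ ≟ L) (allSubsets n) + subsetsOfSize n L
  ∎
  where open ≡-Reasoning

subsetsOfSize-pascal : ∀ n L → subsetsOfSize (suc n) (suc L) ≡ subsetsOfSize n L + subsetsOfSize n (suc L)
subsetsOfSize-pascal n L = trans (subsetsOfSize-suc n (suc L))
  (cong (_+ subsetsOfSize n (suc L)) (count-cong _ _ (allSubsets n) (λ _ → suc-injective) (λ _ → cong suc)))

subsetsOfSize-zero : ∀ n → subsetsOfSize (suc n) 0 ≡ subsetsOfSize n 0
subsetsOfSize-zero n = trans (subsetsOfSize-suc n 0) (cong (_+ subsetsOfSize n 0) (count≡0 _ (allSubsets n) (λ _ ())))

-- the first two terms of the binomial expansion of (n + 1) ^ (L + 1)
binomial-two-terms : ∀ n L → n ^ suc L + suc L * n ^ L ≤ suc n ^ suc L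
binomial-two-terms n zero = ≤-reflexive (+-comm (n * 1) 1)
binomial-two-terms n (suc L) = begin
  n ^ suc (suc L) + suc (suc L) * n ^ suc L
    ≤⟨ m≤m+n _ (suc L * n ^ L) ⟩
  n ^ suc (suc L) + suc (suc L) * n ^ suc L + suc L * n ^ L
    ≡⟨ solve 3 (λ n x l → n :* (n :* x) :+ (con 2 :+ l) :* (n :* x) :+ (con 1 :+ l) :* x
       := (con 1 :+ n) :* (n :* x :+ (con 1 :+ l) :* x)) refl n (n ^ L) L ⟩
  suc n * (n ^ suc L + suc L * n ^ L)
    ≤⟨ *-monoʳ-≤ (suc n) (binomial-two-terms n L) ⟩
  suc n ^ suc (suc L) ∎
  where open ≤-Reasoning

subsetsOfSize*!≤^ : ∀ n L → subsetsOfSize n L * L ! ≤ n ^ L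
subsetsOfSize*!≤^ zero zero = ≤-refl
subsetsOfSize*!≤^ zero (suc L) = z≤n
subsetsOfSize*!≤^ (suc n) zero = subst (λ z → z * 1 ≤ 1) (sym (subsetsOfSize-zero n)) (subsetsOfSize*!≤^ n zero)
subsetsOfSize*!≤^ (suc n) (suc L) = begin
  subsetsOfSize (suc n) (suc L) * suc L !
    ≡⟨ cong (_* suc L !) (subsetsOfSize-pascal n L) ⟩
  (subsetsOfSize n L + subsetsOfSize n (suc L)) * suc L !
    ≡⟨ *-distribʳ-+ (suc L !) (subsetsOfSize n L) _ ⟩
  subsetsOfSize n L * (suc L * L !) + subsetsOfSize n (suc L) * suc L !
    ≡⟨ cong (_+ subsetsOfSize n (suc L) * suc L !) (x∙yz≈y∙xz (subsetsOfSize n L) (suc L) (L !)) ⟩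
  suc L * (subsetsOfSize n L * L !) + subsetsOfSize n (suc L) * suc L !
    ≤⟨ +-mono-≤ (*-monoʳ-≤ (suc L) (subsetsOfSize*!≤^ n L)) (subsetsOfSize*!≤^ n (suc L)) ⟩
  suc L * n ^ L + n ^ suc L
    ≡⟨ +-comm (suc L * n ^ L) (n ^ suc L) ⟩
  n ^ suc L + suc L * n ^ L
    ≤⟨ binomial-two-terms n L ⟩
  suc n ^ suc L ∎
  where open ≤-Reasoning

zipWith-AllPairs : ∀ {A B C : Set} {R : A → A → Set} {S : B → B → Set} {T : C → C → Set} (f : A → B → C) →
  (∀ {a a′ b b′} → R a a′ → S b b′ → T (f a b) (f a′ b′)) →
  ∀ {xs ys} → AllPairs R xs → AllPairs S ys → AllPairs T (zipWith f xs ys)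
zipWith-AllPairs f h {[]} _ _ = []
zipWith-AllPairs f h {_ ∷ _} {[]} _ _ = []
zipWith-AllPairs f h {x ∷ xs} {y ∷ ys} (rx ∷ rxs) (sy ∷ sys) = heads rx sy ∷ zipWith-AllPairs f h rxs sys
  where
  heads : ∀ {xs′ ys′} → All _ xs′ → All _ ys′ → All _ (zipWith f xs′ ys′)
  heads {[]} _ _ = []
  heads {_ ∷ _} {[]} _ _ = []
  heads {_ ∷ _} {_ ∷ _} (r ∷ rs) (s ∷ ss) = h r s ∷ heads rs ss

All-zipWith : ∀ {A B C : Set} {P : C → Set} (f : A → B → C) → (∀ a b → P (f a b)) → ∀ xs ys → All P (zipWith f xs ys)
All-zipWith f h [] _ = []
All-zipWith f h (_ ∷ _) [] = []
All-zipWith f h (x ∷ xs) (y ∷ ys) = h x y ∷ All-zipWith f h xs ys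

module SubsetShift (k : ℕ) (i : Fin k) (A B : Subset k) where

  fromEnd : Fin k → ℕ
  fromEnd a = k ∸ suc (toℕ a)

  fromEnd<k : ∀ a → fromEnd a < k
  fromEnd<k a = ∸-monoʳ-< (s≤s z≤n) (toℕ<n a)

  ps : List (ℕ × ℕ)
  ps = zipWith (λ a b → fromEnd a , fromEnd b) (elems A) (elems B)

  ps<k : All (λ p → proj₁ p < k × proj₂ p < k) ps
  ps<k = All-zipWith _ (λ a b → fromEnd<k a , fromEnd<k b) (elems A) (elems B)

  ps-decreasing : AllPairs (λ p q → proj₁ q < proj₁ p × proj₂ q < proj₂ p) ps
  ps-decreasing = zipWith-AllPairs _ (λ a<a′ b<b′ → reverse a<a′ , reverse b<b′) (elems-increasing A) (elems-increasing B)
    where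
    reverse : ∀ {a a′} → toℕ a < toℕ a′ → fromEnd a′ < fromEnd a
    reverse {a′ = a′} a<a′ = ∸-monoʳ-< (s≤s a<a′) (toℕ<n a′)

  length-ps : ∀ {L} → ∣ A ∣ ≡ L → ∣ B ∣ ≡ L → length ps ≡ L
  length-ps {L} ∣A∣≡L ∣B∣≡L = begin
    length ps
      ≡⟨ length-zipWith _ (elems A) (elems B) ⟩
    length (elems A) ⊓ length (elems B)
      ≡⟨ cong₂ _⊓_ (trans (sym (card≡length-elems A)) ∣A∣≡L) (trans (sym (card≡length-elems B)) ∣B∣≡L) ⟩
    L ⊓ L
      ≡⟨ ⊓-idem L ⟩
    L ∎
    where open ≡-Reasoning

  open ShiftCount k (toℕ i) ps ps<k ps-decreasing public

  shift⇒satisfies : ∀ (π : Vec (Fin k) k) → IsShift (lookup π) (suc (toℕ i)) A B → Satisfies π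
  shift⇒satisfies π shift = All.zipWith⁺ _ (Pointwise.map (λ {a} {b} e → subst₂ Related (sym (at-lookup π a)) (sym (at-lookup π b)) e) shift)

  count-shifts : ∀ {L} → ∣ A ∣ ≡ L → ∣ B ∣ ≡ L → 1 ≤ k → L + L ≤ k →
    count (λ π → unique? (toList π) ×-dec isShift? (lookup π) (suc (toℕ i)) A B) (allVecsOf (allFin k) k) * (k ∸ (L + L)) ^ (L + L) ≤ k ^ L * k !
  count-shifts {L} ∣A∣≡L ∣B∣≡L 1≤k 2L≤k rewrite sym (length-ps ∣A∣≡L ∣B∣≡L) =
    ≤-trans (*-monoˡ-≤ ((k ∸ (L′ + L′)) ^ (L′ + L′)) (count-mono _ _ (allVecsOf (allFin k) k) shift⇒satisfying))
            (count-satisfying*[k∸2L]^2L≤k^L*k! 1≤k 2L≤k)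
    where
    L′ = length ps
    shift⇒satisfying : ∀ {π} → _ → Unique (toList π) × IsShift (lookup π) (suc (toℕ i)) A B → Unique (toList π) × Satisfies π
    shift⇒satisfying {π} _ (u , shift) = u , shift⇒satisfies π shift

length-cartesianProduct : ∀ {A B : Set} (xs : List A) (ys : List B) → length (cartesianProduct xs ys) ≡ length xs * length ys
length-cartesianProduct [] ys = refl
length-cartesianProduct (x ∷ xs) ys =
  trans (length-++ (map (x ,_) ys)) (cong₂ _+_ (length-map (x ,_) ys) (length-cartesianProduct xs ys))

-- Bad permutations

searchSquareAbove : ℕ → ℕ → ℕ → ℕ
searchSquareAbove m zero n = n
searchSquareAbove m (suc fuel) n with m <? n * n
... | yes _ = n
... | no _ = searchSquareAbove m fuel (suc n)

searchSquareAbove-spec : ∀ m fuel n → m < (n + fuel) * (n + fuel) → (∀ {j} → j < n → j * j ≤ m) →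
  let T = searchSquareAbove m fuel n in m < T * T × (∀ {j} → j < T → j * j ≤ m)
searchSquareAbove-spec m zero n m<n² below = subst (λ z → m < z * z) (+-identityʳ n) m<n² , below
searchSquareAbove-spec m (suc fuel) n m<[n+fuel]² below with m <? n * n
... | yes m<n² = m<n² , below
... | no m≮n² = searchSquareAbove-spec m fuel (suc n) (subst (λ z → m < z * z) (+-suc n fuel) m<[n+fuel]²) below′
  where
  below′ : ∀ {j} → j < suc n → j * j ≤ m
  below′ {j} j<1+n with j ≟ n
  ... | yes refl = ≮⇒≥ m≮n²
  ... | no j≢n = below (≤∧≢⇒< (≤-pred j<1+n) j≢n)

-- the least T with 9k < T², i.e. the least integer exceeding 3√k
opaque
  threshold : ℕ → ℕ
  threshold k = searchSquareAbove (9 * k) (suc (9 * k)) 0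

  threshold-spec : ∀ k → 9 * k < threshold k * threshold k × (∀ {j} → j < threshold k → j * j ≤ 9 * k)
  threshold-spec k = searchSquareAbove-spec (9 * k) (suc (9 * k)) 0 (m≤m*n (suc (9 * k)) (suc (9 * k))) (λ ())

threshold-least : ∀ k M → 9 * k < M * M → threshold k ≤ M
threshold-least k M 9k<M² with threshold k ≤? M
... | yes T≤M = T≤M
... | no T≰M = ⊥-elim (<⇒≱ 9k<M² (proj₂ (threshold-spec k) (≰⇒> T≰M)))

threshold-positive : ∀ k → 1 ≤ threshold k
threshold-positive k with threshold k | proj₁ (threshold-spec k)
... | zero | ()
... | suc _ | _ = s≤s z≤n

m*m≤n*n⇒m≤n : ∀ {m n} → m * m ≤ n * n → m ≤ n
m*m≤n*n⇒m≤n {m} {n} m²≤n² with m ≤? n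
... | yes m≤n = m≤n
... | no m≰n = ⊥-elim (<⇒≱ (*-mono-< (≰⇒> m≰n) (≰⇒> m≰n)) m²≤n²)

module _ (k : ℕ) where

  private
    T = threshold k

  2≤threshold : 1 ≤ k → 2 ≤ T
  2≤threshold 1≤k with 2 ≤? T
  ... | yes 2≤T = 2≤T
  ... | no 2≰T = ⊥-elim (<⇒≱ (proj₁ (threshold-spec k)) (≤-trans (*-mono-≤ T≤1 T≤1) (≤-trans 1≤k (m≤n*m k 9))))
    where
    T≤1 : T ≤ 1
    T≤1 = ≤-pred (≰⇒> 2≰T)

  400*below-threshold≤k : 1440000 ≤ k → ∀ t → t < T → 400 * t ≤ k
  400*below-threshold≤k 1440000≤k t t<T = m*m≤n*n⇒m≤n {400 * t} {k} (begin
    400 * t * (400 * t)     ≡⟨ *-interchange 400 t 400 t ⟩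
    400 * 400 * (t * t)     ≤⟨ *-monoʳ-≤ (400 * 400) (proj₂ (threshold-spec k) t<T) ⟩
    400 * 400 * (9 * k)     ≡⟨ *-assoc (400 * 400) 9 k ⟨
    400 * 400 * 9 * k       ≤⟨ *-monoˡ-≤ k {400 * 400 * 9} 1440000≤k ⟩
    k * k                   ∎)
    where open ≤-Reasoning

  200*threshold≤k : 1440000 ≤ k → 200 * T ≤ k
  200*threshold≤k 1440000≤k = begin
    200 * T       ≡⟨ cong (200 *_) T≡1+t ⟩
    200 * suc t   ≤⟨ *-monoʳ-≤ 200 (+-monoˡ-≤ t 1≤t) ⟩
    200 * (t + t) ≡⟨ solve 1 (λ t → con 200 :* (t :+ t) := con 400 :* t) refl t ⟩
    400 * t       ≤⟨ 400*below-threshold≤k 1440000≤k t (subst (t <_) (sym T≡1+t) ≤-refl) ⟩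
    k             ∎
    where
    open ≤-Reasoning
    t = T ∸ 1
    2≤T = 2≤threshold (≤-trans (s≤s z≤n) 1440000≤k)
    T≡1+t : T ≡ suc t
    T≡1+t = sym (m+[n∸m]≡n (≤-trans (s≤s z≤n) 2≤T))
    1≤t : 1 ≤ t
    1≤t = ≤-pred (subst (2 ≤_) T≡1+t 2≤T)

  ≤threshold : ∀ c → c * c ≤ k → c ≤ T
  ≤threshold c c²≤k = m*m≤n*n⇒m≤n {c} {T} (≤-trans c²≤k (≤-trans (m≤n*m k 9) (<⇒≤ (proj₁ (threshold-spec k)))))

<foldr-⊔⇒ : ∀ {X : Set} (f : X → ℕ) (xs : List X) {t} → t < foldr _⊔_ 0 (map f xs) → Σ X (λ x → x ∈ xs × t < f x)
<foldr-⊔⇒ f (x ∷ xs) {t} t<max with t <? f x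
... | yes t<fx = x , here refl , t<fx
... | no t≮fx with ⊔-sel (f x) (foldr _⊔_ 0 (map f xs))
...   | inj₁ e = ⊥-elim (t≮fx (subst (t <_) e t<max))
...   | inj₂ e = let (y , y∈ , t<fy) = <foldr-⊔⇒ f xs (subst (t <_) e t<max) in y , there y∈ , t<fy

<LΔ⇒shift : ∀ {k} (π : Fin k → Fin k) Δ {t} → t < LΔ π Δ → Σ (Subset k) λ A → Σ (Subset k) λ B → IsShift π Δ A B × t < ∣ A ∣
<LΔ⇒shift {k} π Δ t<L with <foldr-⊔⇒ _ (cartesianProduct (allSubsets k) (allSubsets k)) t<L
... | (A , B) , _ , t<size with isShift? π Δ A B
...   | yes shift = A , B , shift , t<size

module _ (k : ℕ) where

  private
    T : ℕ
    T = threshold k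

  IsBad : Vec (Fin k) k → Set
  IsBad v = IsPerm (lookup v) × ¬ Good (lookup v)

  isBad? : Decidable IsBad
  isBad? v = isPerm? (lookup v) ×-dec ¬? (good? (lookup v))

  badCount≡count : badCount k ≡ count isBad? (allVecsOf (allFin k) k)
  badCount≡count = trans (length-filter≡count _ (allMaps k)) (count-map (λ π → isPerm? π ×-dec ¬? (good? π)) lookup (allVecsOf (allFin k) k))

  sizeT : List (Subset k)
  sizeT = filter (λ A → ∣ A ∣ ≟ T) (allSubsets k)

  triples : List (Fin k × Subset k × Subset k)
  triples = cartesianProduct (allFin k) (cartesianProduct sizeT sizeT)

  length-triples : length triples ≡ k * (subsetsOfSize k T * subsetsOfSize k T)
  length-triples = begin
    length triples
      ≡⟨ length-cartesianProduct (allFin k) _ ⟩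
    length (allFin k) * length (cartesianProduct sizeT sizeT)
      ≡⟨ cong₂ _*_ (length-allFin k) (length-cartesianProduct sizeT sizeT) ⟩
    k * (length sizeT * length sizeT)
      ≡⟨ cong (λ n → k * (n * n)) (length-filter≡count (λ A → ∣ A ∣ ≟ T) (allSubsets k)) ⟩
    k * (subsetsOfSize k T * subsetsOfSize k T) ∎
    where open ≡-Reasoning

  HasShift : Fin k × Subset k × Subset k → Vec (Fin k) k → Set
  HasShift (i , A , B) v = Unique (toList v) × IsShift (lookup v) (suc (toℕ i)) A B

  hasShift? : ∀ w → Decidable (HasShift w)
  hasShift? (i , A , B) v = unique? (toList v) ×-dec isShift? (lookup v) (suc (toℕ i)) A B

  -- some LΔ is at least T, and the first T elements of a Δ-shift form a Δ-shift
  bad⇒shift : ∀ {v} → IsBad v → Σ (Fin k × Subset k × Subset k) (λ w → w ∈ triples × HasShift w v)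
  bad⇒shift {v} (perm , ¬good) =
    (i , takeSubset T A′ , takeSubset T B′) ,
    ∈-cartesianProduct⁺ (∈-allFin i)
      (∈-cartesianProduct⁺ (∈sizeT (card-takeSubset T A′ T≤∣A′∣)) (∈sizeT (card-takeSubset T B′ T≤∣B′∣))) ,
    lookup-injective⇒unique v perm , IsShift-takeSubset {π = π} {suc (toℕ i)} {A′} {B′} T shift
    where
    π = lookup v
    violated = ¬∀⟶∃¬ k _ (λ i → LΔ π (suc (toℕ i)) * LΔ π (suc (toℕ i)) ≤? 9 * k) ¬good
    i = proj₁ violated
    1≤T = threshold-positive k
    witness = <LΔ⇒shift π (suc (toℕ i)) (≤-trans (≤-reflexive (m+[n∸m]≡n 1≤T)) (threshold-least k _ (≰⇒> (proj₂ violated))))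
    A′ = proj₁ witness
    B′ = proj₁ (proj₂ witness)
    shift = proj₁ (proj₂ (proj₂ witness))
    T≤∣A′∣ : T ≤ ∣ A′ ∣
    T≤∣A′∣ = subst (_≤ ∣ A′ ∣) (m+[n∸m]≡n 1≤T) (proj₂ (proj₂ (proj₂ witness)))
    T≤∣B′∣ : T ≤ ∣ B′ ∣
    T≤∣B′∣ = subst (T ≤_) (trans (card≡length-elems A′) (trans (Pointwise-length shift) (sym (card≡length-elems B′)))) T≤∣A′∣
    ∈sizeT : ∀ {C} → ∣ C ∣ ≡ T → C ∈ sizeT
    ∈sizeT {C} = ∈-filter⁺ (λ D → ∣ D ∣ ≟ T) (∈-allSubsets C)

  triples-bound : 1 ≤ k → T + T ≤ k → ∀ w → w ∈ triples →
    count (hasShift? w) (allVecsOf (allFin k) k) * (k ∸ (T + T)) ^ (T + T) ≤ k ^ T * k !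
  triples-bound 1≤k 2T≤k (i , A , B) w∈ =
    let (_ , AB∈) = ∈-cartesianProduct⁻ (allFin k) (cartesianProduct sizeT sizeT) w∈
        (A∈ , B∈) = ∈-cartesianProduct⁻ sizeT sizeT AB∈
        size-T = λ {C} (C∈ : C ∈ sizeT) → proj₂ (∈-filter⁻ (λ D → ∣ D ∣ ≟ T) {xs = allSubsets k} C∈)
    in SubsetShift.count-shifts k i A B (size-T A∈) (size-T B∈) 1≤k 2T≤k

  count-bad : 1 ≤ k → T + T ≤ k → badCount k * (k ∸ (T + T)) ^ (T + T) ≤ k * (subsetsOfSize k T * subsetsOfSize k T) * (k ^ T * k !)
  count-bad 1≤k 2T≤k = begin
    badCount k * d
      ≡⟨ cong (_* d) badCount≡count ⟩
    count isBad? perms * d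
      ≤⟨ *-monoˡ-≤ d (count≤sum-count isBad? hasShift? triples bad⇒shift perms) ⟩
    sum (map (λ w → count (hasShift? w) perms) triples) * d
      ≡⟨ sum-map-*ʳ (λ w → count (hasShift? w) perms) d triples ⟩
    sum (map (λ w → count (hasShift? w) perms * d) triples)
      ≤⟨ sum-map-mono (λ w → count (hasShift? w) perms * d) (λ _ → k ^ T * k !) triples
         (λ {w} → triples-bound 1≤k 2T≤k w) ⟩
    sum (map (λ _ → k ^ T * k !) triples)
      ≡⟨ sum-map-const (k ^ T * k !) triples ⟩
    length triples * (k ^ T * k !)
      ≡⟨ cong (_* (k ^ T * k !)) length-triples ⟩
    k * (subsetsOfSize k T * subsetsOfSize k T) * (k ^ T * k !) ∎
    where
    open ≤-Reasoning
    perms = allVecsOf (allFin k) k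
    d = (k ∸ (T + T)) ^ (T + T)

-- Elementary estimates

[m*n]^o≡m^o*n^o : ∀ m n o → (m * n) ^ o ≡ m ^ o * n ^ o
[m*n]^o≡m^o*n^o m n zero = refl
[m*n]^o≡m^o*n^o m n (suc o) = trans (cong (m * n *_) ([m*n]^o≡m^o*n^o m n o))
  (solve 4 (λ m n x y → m :* n :* (x :* y) := m :* x :* (n :* y)) refl m n (m ^ o) (n ^ o))

*-^-mono-≤ : ∀ a b x y n → a * x ≤ b * y → a ^ n * x ^ n ≤ b ^ n * y ^ n
*-^-mono-≤ a b x y n ax≤by = subst₂ _≤_ ([m*n]^o≡m^o*n^o a x n) ([m*n]^o≡m^o*n^o b y n) (^-monoˡ-≤ n ax≤by)

-- Bernoulli's inequality (1 + 1/N)^m ≥ 1 + m/N, cleared of denominators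
bernoulli : ∀ N m → N ^ m * (N + m) ≤ N * suc N ^ m
bernoulli N zero = ≤-reflexive (trans (+-identityʳ (N + 0)) (trans (+-identityʳ N) (sym (*-identityʳ N))))
bernoulli N (suc m) = begin
  N * N ^ m * (N + suc m)
    ≤⟨ m≤m+n _ (m * N ^ m) ⟩
  N * N ^ m * (N + suc m) + m * N ^ m
    ≡⟨ solve 3 (λ a x b → a :* x :* (a :+ (con 1 :+ b)) :+ b :* x := (con 1 :+ a) :* (x :* (a :+ b))) refl N (N ^ m) m ⟩
  suc N * (N ^ m * (N + m))
    ≤⟨ *-monoʳ-≤ (suc N) (bernoulli N m) ⟩
  suc N * (N * suc N ^ m)
    ≡⟨ x∙yz≈y∙xz (suc N) N (suc N ^ m) ⟩
  N * (suc N * suc N ^ m) ∎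
  where
  open ≤-Reasoning

-- (1 + 1/N)^n ≤ N/(N - n), cleared of denominators
[1+N]^n*[N∸n]≤N^[1+n] : ∀ N n → n ≤ N → suc N ^ n * (N ∸ n) ≤ N ^ suc n
[1+N]^n*[N∸n]≤N^[1+n] N zero _ = ≤-reflexive (trans (*-identityˡ N) (sym (*-identityʳ N)))
[1+N]^n*[N∸n]≤N^[1+n] N (suc n) n<N = begin
  suc N ^ suc n * d            ≡⟨ solve 3 (λ a p d → (con 1 :+ a) :* p :* d := p :* ((con 1 :+ a) :* d)) refl N (suc N ^ n) d ⟩
  suc N ^ n * (suc N * d)      ≤⟨ *-monoʳ-≤ (suc N ^ n) (subst₂ _≤_ (solve 2 (λ a d → a :* d :+ d := (con 1 :+ a) :* d) refl N d)
                                                                   (solve 2 (λ a d → a :* d :+ a := a :* (con 1 :+ d)) refl N d)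
                                                                   (+-monoʳ-≤ (N * d) (m∸n≤m N (suc n)))) ⟩
  suc N ^ n * (N * suc d)      ≡⟨ solve 3 (λ p a d → p :* (a :* d) := a :* (p :* d)) refl (suc N ^ n) N (suc d) ⟩
  N * (suc N ^ n * suc d)      ≡⟨ cong (λ z → N * (suc N ^ n * z)) (+-∸-assoc 1 n<N) ⟨
  N * (suc N ^ n * (N ∸ n))    ≤⟨ *-monoʳ-≤ N ([1+N]^n*[N∸n]≤N^[1+n] N n (<⇒≤ n<N)) ⟩
  N * N ^ suc n                ∎
  where
  open ≤-Reasoning
  d = N ∸ suc n

cross-≤ : ∀ a b c d X Y → a * X ≤ b * Y → c * Y ≤ d * X → a * c * X ≤ b * d * X
cross-≤ a b c d X Y aX≤bY cY≤dX = begin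
  a * c * X     ≡⟨ solve 3 (λ a c x → a :* c :* x := c :* (a :* x)) refl a c X ⟩
  c * (a * X)   ≤⟨ *-monoʳ-≤ c aX≤bY ⟩
  c * (b * Y)   ≡⟨ solve 3 (λ c b y → c :* (b :* y) := b :* (c :* y)) refl c b Y ⟩
  b * (c * Y)   ≤⟨ *-monoʳ-≤ b cY≤dX ⟩
  b * (d * X)   ≡⟨ *-assoc b d X ⟨
  b * d * X     ∎
  where open ≤-Reasoning

-- (1 + 1/L)^L ≤ (1 + 1/(10L))^(10L) ≤ (10/9)^10
[1+L]^L*9^10≤L^L*10^10 : ∀ L → suc L ^ L * 9 ^ 10 ≤ L ^ L * 10 ^ 10
[1+L]^L*9^10≤L^L*10^10 zero = subst₂ _≤_ (sym (*-identityˡ (9 ^ 10))) (sym (*-identityˡ (10 ^ 10))) (^-monoˡ-≤ 10 {9} {10} (n≤1+n 9))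
[1+L]^L*9^10≤L^L*10^10 L@(suc _) =
  *-cancelʳ-≤ (suc L ^ L * 9 ^ 10) (L ^ L * 10 ^ 10) U {{m^n≢0 (10 * L) (10 * L)}}
    (cross-≤ (suc L ^ L) (L ^ L) (9 ^ 10) (10 ^ 10) U V coarse fine)
  where
  open ≤-Reasoning
  U = (10 * L) ^ (10 * L)
  V = suc (10 * L) ^ (10 * L)
  ^L*10 : ∀ x → (x ^ L) ^ 10 ≡ x ^ (10 * L)
  ^L*10 x = trans (^-*-assoc x L 10) (cong (x ^_) (*-comm L 10))
  one-step : suc L * (10 * L) ^ 10 ≤ L * suc (10 * L) ^ 10
  one-step = *-cancelˡ-≤ 10 (subst₂ _≤_
    (solve 2 (λ l x → x :* (con 10 :* l :+ con 10) := con 10 :* ((con 1 :+ l) :* x)) refl L ((10 * L) ^ 10))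
    (*-assoc 10 L _) (bernoulli (10 * L) 10))
  coarse : suc L ^ L * U ≤ L ^ L * V
  coarse = subst₂ (λ x y → suc L ^ L * x ≤ L ^ L * y) (^-*-assoc (10 * L) 10 L) (^-*-assoc (suc (10 * L)) 10 L)
                  (*-^-mono-≤ (suc L) L ((10 * L) ^ 10) (suc (10 * L) ^ 10) L one-step)
  tenth : 9 * suc (10 * L) ^ L ≤ 10 * (10 * L) ^ L
  tenth = *-cancelʳ-≤ _ _ L (subst₂ _≤_
    (trans (cong (suc (10 * L) ^ L *_) (trans (cong (_∸ L) (solve 1 (λ l → con 10 :* l := con 9 :* l :+ l) refl L)) (m+n∸n≡m (9 * L) L)))
           (solve 2 (λ y l → y :* (con 9 :* l) := con 9 :* y :* l) refl (suc (10 * L) ^ L) L))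
    (solve 2 (λ l x → con 10 :* l :* x := con 10 :* x :* l) refl L ((10 * L) ^ L))
    ([1+N]^n*[N∸n]≤N^[1+n] (10 * L) L (m≤n*m L 10)))
  fine : 9 ^ 10 * V ≤ 10 ^ 10 * U
  fine = subst₂ (λ y x → 9 ^ 10 * y ≤ 10 ^ 10 * x) (^L*10 (suc (10 * L))) (^L*10 (10 * L))
                (*-^-mono-≤ 9 10 (suc (10 * L) ^ L) ((10 * L) ^ L) 10 tenth)


factorial-lower-bound : ∀ c d → (∀ L → suc L ^ L * c ≤ L ^ L * d) → ∀ L → L ^ L * c ^ L ≤ L ! * d ^ L
factorial-lower-bound c d step zero = ≤-refl
factorial-lower-bound c d step (suc L) = begin
  suc L ^ suc L * c ^ suc L
    ≡⟨ solve 4 (λ s p c q → s :* p :* (c :* q) := s :* (p :* c) :* q) refl (suc L) (suc L ^ L) c (c ^ L) ⟩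
  suc L * (suc L ^ L * c) * c ^ L
    ≤⟨ *-monoˡ-≤ (c ^ L) (*-monoʳ-≤ (suc L) (step L)) ⟩
  suc L * (L ^ L * d) * c ^ L
    ≡⟨ solve 4 (λ s p d q → s :* (p :* d) :* q := s :* d :* (p :* q)) refl (suc L) (L ^ L) d (c ^ L) ⟩
  suc L * d * (L ^ L * c ^ L)
    ≤⟨ *-monoʳ-≤ (suc L * d) (factorial-lower-bound c d step L) ⟩
  suc L * d * (L ! * d ^ L)
    ≡⟨ solve 4 (λ s d f q → s :* d :* (f :* q) := s :* f :* (d :* q)) refl (suc L) d (L !) (d ^ L) ⟩
  suc L ! * d ^ suc L ∎
  where open ≤-Reasoning

-- a weak form of Stirling's formula, as 0.9¹⁰ < 1/e
stirling : ∀ L → L ^ L * (9 ^ 10) ^ L ≤ L ! * (10 ^ 10) ^ L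
stirling = factorial-lower-bound (9 ^ 10) (10 ^ 10) [1+L]^L*9^10≤L^L*10^10

-- the induction step works because 20 (x + 1)³ ≤ 21 x³ once x ≥ 61
20^L*[L+61]^3≤61^3*21^L : ∀ L → 20 ^ L * (L + 61) ^ 3 ≤ 61 ^ 3 * 21 ^ L
20^L*[L+61]^3≤61^3*21^L zero = ≤-refl
20^L*[L+61]^3≤61^3*21^L (suc L) = begin
  20 * 20 ^ L * (suc L + 61) ^ 3
    ≡⟨ solve 2 (λ p x → con 20 :* p :* x := p :* (con 20 :* x)) refl (20 ^ L) ((suc L + 61) ^ 3) ⟩
  20 ^ L * (20 * (suc L + 61) ^ 3)
    ≤⟨ *-monoʳ-≤ (20 ^ L) step ⟩
  20 ^ L * (21 * (L + 61) ^ 3)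
    ≡⟨ solve 2 (λ p x → p :* (con 21 :* x) := con 21 :* (p :* x)) refl (20 ^ L) ((L + 61) ^ 3) ⟩
  21 * (20 ^ L * (L + 61) ^ 3)
    ≤⟨ *-monoʳ-≤ 21 (20^L*[L+61]^3≤61^3*21^L L) ⟩
  21 * (61 ^ 3 * 21 ^ L)
    ≡⟨ x∙yz≈y∙xz 21 (61 ^ 3) (21 ^ L) ⟩
  61 ^ 3 * (21 * 21 ^ L) ∎
  where
  open ≤-Reasoning
  step : 20 * (suc L + 61) ^ 3 ≤ 21 * (L + 61) ^ 3
  step = subst (20 * (suc L + 61) ^ 3 ≤_)
    (solve 1 (λ l → con 20 :* (con 1 :+ l :+ con 61) :^ 3 :+ (l :^ 3 :+ con 123 :* l :^ 2 :+ con 3783 :* l :+ con 41)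
                  := con 21 :* (l :+ con 61) :^ 3) refl L)
    (m≤m+n _ _)

polynomial≤exponential : ∀ s L → s * 61 ^ 3 ≤ L → s * (L * L) * 20 ^ L ≤ 21 ^ L
polynomial≤exponential s L = cancel (61 ^ 3) (20^L*[L+61]^3≤61^3*21^L L)
  where
  cancel : ∀ c .{{_ : NonZero c}} → 20 ^ L * (L + 61) ^ 3 ≤ c * 21 ^ L → s * c ≤ L → s * (L * L) * 20 ^ L ≤ 21 ^ L
  cancel c 20ᴸ[L+61]³≤c21ᴸ sc≤L = *-cancelˡ-≤ c (begin
    c * (s * (L * L) * 20 ^ L)
      ≡⟨ solve 4 (λ c s l p → c :* (s :* (l :* l) :* p) := s :* c :* (l :* l) :* p) refl c s L (20 ^ L) ⟩
    s * c * (L * L) * 20 ^ L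
      ≤⟨ *-monoˡ-≤ (20 ^ L) (*-monoˡ-≤ (L * L) sc≤L) ⟩
    L * (L * L) * 20 ^ L
      ≤⟨ *-monoˡ-≤ (20 ^ L) (subst (_≤ (L + 61) ^ 3) (solve 1 (λ l → l :^ 3 := l :* (l :* l)) refl L) (^-monoˡ-≤ 3 (m≤m+n L 61))) ⟩
    (L + 61) ^ 3 * 20 ^ L
      ≡⟨ *-comm ((L + 61) ^ 3) (20 ^ L) ⟩
    20 ^ L * (L + 61) ^ 3
      ≤⟨ 20ᴸ[L+61]³≤c21ᴸ ⟩
    c * 21 ^ L ∎)
    where open ≤-Reasoning

-- the two halves of s k N² k^T ≤ d^(2T), multiplied through by (T! b^T)²
estimate-numerator : ∀ s k T N F b → N * F ≤ k ^ T →
  s * (k * (N * N) * k ^ T) * ((F * b ^ T) * (F * b ^ T)) ≤ s * k * (k * k * (b * b)) ^ T * k ^ T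
estimate-numerator s k T N F b NF≤kᵀ = begin
  s * (k * (N * N) * kᵀ) * ((F * bᵀ) * (F * bᵀ))
    ≡⟨ solve 6 (λ s k n f x y → s :* (k :* (n :* n) :* x) :* ((f :* y) :* (f :* y))
       := s :* k :* ((n :* f) :* (n :* f)) :* x :* (y :* y)) refl s k N F kᵀ bᵀ ⟩
  s * k * ((N * F) * (N * F)) * kᵀ * (bᵀ * bᵀ)
    ≤⟨ *-monoˡ-≤ (bᵀ * bᵀ) (*-monoˡ-≤ kᵀ (*-monoʳ-≤ (s * k) (*-mono-≤ NF≤kᵀ NF≤kᵀ))) ⟩
  s * k * (kᵀ * kᵀ) * kᵀ * (bᵀ * bᵀ)
    ≡⟨ solve 4 (λ a x y z → a :* (x :* x) :* z :* (y :* y) := a :* (x :* x :* (y :* y)) :* z) refl (s * k) kᵀ bᵀ kᵀ ⟩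
  s * k * (kᵀ * kᵀ * (bᵀ * bᵀ)) * kᵀ
    ≡⟨ cong (λ z → s * k * z * kᵀ) powers ⟨
  s * k * (k * k * (b * b)) ^ T * kᵀ ∎
  where
  open ≤-Reasoning
  kᵀ = k ^ T
  bᵀ = b ^ T
  powers : (k * k * (b * b)) ^ T ≡ kᵀ * kᵀ * (bᵀ * bᵀ)
  powers = trans ([m*n]^o≡m^o*n^o (k * k) (b * b) T) (cong₂ _*_ ([m*n]^o≡m^o*n^o k k T) ([m*n]^o≡m^o*n^o b b T))

estimate-denominator : ∀ k T d F a b → 9 * k ≤ T * T → T ^ T * a ^ T ≤ F * b ^ T →
  (d * d * (9 * (a * a))) ^ T * k ^ T ≤ d ^ (T + T) * ((F * b ^ T) * (F * b ^ T))
estimate-denominator k T d F a b 9k≤T² stirling-ratio = begin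
  (d * d * (9 * (a * a))) ^ T * kᵀ
    ≡⟨ cong (_* kᵀ) powers ⟩
  dᵀ * dᵀ * (9 ^ T * (aᵀ * aᵀ)) * kᵀ
    ≡⟨ solve 5 (λ d n c k a → d :* d :* (n :* c) :* k := d :* d :* ((n :* k) :* c)) refl dᵀ (9 ^ T) (aᵀ * aᵀ) kᵀ aᵀ ⟩
  dᵀ * dᵀ * ((9 ^ T * kᵀ) * (aᵀ * aᵀ))
    ≡⟨ cong (λ z → dᵀ * dᵀ * (z * (aᵀ * aᵀ))) ([m*n]^o≡m^o*n^o 9 k T) ⟨
  dᵀ * dᵀ * ((9 * k) ^ T * (aᵀ * aᵀ))
    ≤⟨ *-monoʳ-≤ (dᵀ * dᵀ) (*-monoˡ-≤ (aᵀ * aᵀ) (^-monoˡ-≤ T 9k≤T²)) ⟩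
  dᵀ * dᵀ * ((T * T) ^ T * (aᵀ * aᵀ))
    ≡⟨ cong (λ z → dᵀ * dᵀ * (z * (aᵀ * aᵀ))) ([m*n]^o≡m^o*n^o T T T) ⟩
  dᵀ * dᵀ * (T ^ T * T ^ T * (aᵀ * aᵀ))
    ≡⟨ cong (dᵀ * dᵀ *_) (solve 2 (λ t a → t :* t :* (a :* a) := (t :* a) :* (t :* a)) refl (T ^ T) aᵀ) ⟩
  dᵀ * dᵀ * ((T ^ T * aᵀ) * (T ^ T * aᵀ))
    ≤⟨ *-monoʳ-≤ (dᵀ * dᵀ) (*-mono-≤ stirling-ratio stirling-ratio) ⟩
  dᵀ * dᵀ * ((F * b ^ T) * (F * b ^ T))
    ≡⟨ cong (_* ((F * b ^ T) * (F * b ^ T))) (^-distribˡ-+-* d T T) ⟨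
  d ^ (T + T) * ((F * b ^ T) * (F * b ^ T)) ∎
  where
  open ≤-Reasoning
  kᵀ = k ^ T
  dᵀ = d ^ T
  aᵀ = a ^ T
  powers : (d * d * (9 * (a * a))) ^ T ≡ dᵀ * dᵀ * (9 ^ T * (aᵀ * aᵀ))
  powers = trans ([m*n]^o≡m^o*n^o (d * d) (9 * (a * a)) T)
                 (cong₂ _*_ ([m*n]^o≡m^o*n^o d d T) (trans ([m*n]^o≡m^o*n^o 9 (a * a) T) (cong (9 ^ T *_) ([m*n]^o≡m^o*n^o a a T))))

-- 21/20 ≤ 9 · 0.99² · (0.9¹⁰)², checked numerically, since d ≥ 0.99 k
ratio-base : ∀ k T → 200 * T ≤ k → 21 * (k * k * (10 ^ 10 * 10 ^ 10)) ≤ 20 * ((k ∸ (T + T)) * (k ∸ (T + T)) * (9 * (9 ^ 10 * 9 ^ 10)))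
ratio-base k T 200T≤k = cross (k * k) (d * d) (10 ^ 10 * 10 ^ 10) (9 * (9 ^ 10 * 9 ^ 10)) 9999 9801 numeric 99²k²≤100²d²
  where
  d = k ∸ (T + T)
  numeric : 21 * (10 ^ 10 * 10 ^ 10) * 10000 ≤ 20 * (9 * (9 ^ 10 * 9 ^ 10)) * 9801
  numeric = ≤ᵇ⇒≤ (21 * (10 ^ 10 * 10 ^ 10) * 10000) (20 * (9 * (9 ^ 10 * 9 ^ 10)) * 9801) _
  cross : ∀ P Q A B t S → 21 * A * suc t ≤ 20 * B * S → S * P ≤ suc t * Q → 21 * (P * A) ≤ 20 * (Q * B)
  cross P Q A B t S 21A[1+t]≤20BS SP≤[1+t]Q = *-cancelˡ-≤ (suc t) (begin
    suc t * (21 * (P * A)) ≡⟨ solve 4 (λ t p x c → t :* (c :* (p :* x)) := c :* x :* t :* p) refl (suc t) P A 21 ⟩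
    21 * A * suc t * P     ≤⟨ *-monoˡ-≤ P 21A[1+t]≤20BS ⟩
    20 * B * S * P         ≡⟨ *-assoc (20 * B) S P ⟩
    20 * B * (S * P)       ≤⟨ *-monoʳ-≤ (20 * B) SP≤[1+t]Q ⟩
    20 * B * (suc t * Q)   ≡⟨ solve 4 (λ a b t q → a :* b :* (t :* q) := t :* (a :* (q :* b))) refl 20 B (suc t) Q ⟩
    suc t * (20 * (Q * B)) ∎)
    where open ≤-Reasoning
  99k≤100d : 99 * k ≤ 100 * d
  99k≤100d = begin
    99 * k                   ≡⟨ m+n∸n≡m (99 * k) k ⟨
    99 * k + k ∸ k           ≡⟨ cong (_∸ k) (solve 1 (λ k → con 99 :* k :+ k := con 100 :* k) refl k) ⟩
    100 * k ∸ k              ≤⟨ ∸-monoʳ-≤ (100 * k) 200T≤k ⟩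
    100 * k ∸ 200 * T        ≡⟨ cong (100 * k ∸_) (solve 1 (λ t → con 200 :* t := con 100 :* (t :+ t)) refl T) ⟩
    100 * k ∸ 100 * (T + T)  ≡⟨ *-distribˡ-∸ 100 k (T + T) ⟨
    100 * d                  ∎
    where open ≤-Reasoning
  99²k²≤100²d² : 9801 * (k * k) ≤ 10000 * (d * d)
  99²k²≤100²d² = subst₂ _≤_ (*-interchange 99 k 99 k) (*-interchange 100 d 100 d) (*-mono-≤ 99k≤100d 99k≤100d)

power-ratio : ∀ s k T X Y → 21 * X ≤ 20 * Y → s * k * 20 ^ T ≤ 21 ^ T → s * k * X ^ T ≤ Y ^ T
power-ratio s k T X Y 21X≤20Y sk20ᵀ≤21ᵀ = *-cancelʳ-≤ (s * k * X ^ T) (Y ^ T) (20 ^ T) {{m^n≢0 20 T}} (begin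
  s * k * X ^ T * 20 ^ T  ≡⟨ solve 3 (λ a x t → a :* x :* t := a :* t :* x) refl (s * k) (X ^ T) (20 ^ T) ⟩
  s * k * 20 ^ T * X ^ T  ≤⟨ *-monoˡ-≤ (X ^ T) sk20ᵀ≤21ᵀ ⟩
  21 ^ T * X ^ T          ≤⟨ *-^-mono-≤ 21 20 X Y T 21X≤20Y ⟩
  20 ^ T * Y ^ T          ≡⟨ *-comm (20 ^ T) (Y ^ T) ⟩
  Y ^ T * 20 ^ T          ∎)
  where open ≤-Reasoning

module _ (s k : ℕ) (1440000≤k : 1440000 ≤ k) (s61³≤T : s * 61 ^ 3 ≤ threshold k) where

  private
    T = threshold k
    d = k ∸ (T + T)
    N = subsetsOfSize k T
    stirlingFactor = (T ! * (10 ^ 10) ^ T) * (T ! * (10 ^ 10) ^ T)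

  9k≤T² : 9 * k ≤ T * T
  9k≤T² = <⇒≤ (proj₁ (threshold-spec k))

  2T<k : T + T < k
  2T<k = begin-strict
    T + T         <⟨ m<m+n (T + T) (≤-trans (s≤s z≤n) (2≤threshold k (≤-trans (s≤s z≤n) 1440000≤k))) ⟩
    T + T + T     ≡⟨ solve 1 (λ t → t :+ t :+ t := con 3 :* t) refl T ⟩
    3 * T         ≤⟨ *-monoˡ-≤ T {3} {200} (s≤s (s≤s (s≤s z≤n))) ⟩
    200 * T       ≤⟨ 200*threshold≤k k 1440000≤k ⟩
    k             ∎
    where open ≤-Reasoning

  bad-ratio : s * (k * (N * N) * k ^ T) ≤ d ^ (T + T)
  bad-ratio = *-cancelʳ-≤ _ _ stirlingFactor {{m*n≢0 _ _ {{nz}} {{nz}}}} (begin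
    s * (k * (N * N) * k ^ T) * stirlingFactor
      ≤⟨ estimate-numerator s k T N (T !) (10 ^ 10) (subsetsOfSize*!≤^ k T) ⟩
    s * k * (k * k * (10 ^ 10 * 10 ^ 10)) ^ T * k ^ T
      ≤⟨ *-monoˡ-≤ (k ^ T) (power-ratio s k T _ _ (ratio-base k T (200*threshold≤k k 1440000≤k)) polynomial) ⟩
    (d * d * (9 * (9 ^ 10 * 9 ^ 10))) ^ T * k ^ T
      ≤⟨ estimate-denominator k T d (T !) (9 ^ 10) (10 ^ 10) 9k≤T² (stirling T) ⟩
    d ^ (T + T) * stirlingFactor ∎)
    where
    open ≤-Reasoning
    nz : NonZero (T ! * (10 ^ 10) ^ T)
    nz = m*n≢0 (T !) ((10 ^ 10) ^ T) {{T !≢0}} {{m^n≢0 (10 ^ 10) T}}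
    polynomial : s * k * 20 ^ T ≤ 21 ^ T
    polynomial = ≤-trans (*-monoˡ-≤ (20 ^ T) (*-monoʳ-≤ s (≤-trans (m≤n*m k 9) 9k≤T²))) (polynomial≤exponential s T s61³≤T)

  badCount-bound : s * badCount k ≤ permCount k
  badCount-bound = *-cancelʳ-≤ (s * badCount k) (permCount k) (d ^ (T + T)) {{m^n≢0 d (T + T) {{>-nonZero (m<n⇒0<n∸m 2T<k)}}}} (begin
    s * badCount k * d ^ (T + T)
      ≡⟨ *-assoc s (badCount k) (d ^ (T + T)) ⟩
    s * (badCount k * d ^ (T + T))
      ≤⟨ *-monoʳ-≤ s (count-bad k (≤-trans (s≤s z≤n) 1440000≤k) (<⇒≤ 2T<k)) ⟩
    s * (k * (N * N) * (k ^ T * k !))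
      ≡⟨ cong (s *_) (*-assoc (k * (N * N)) (k ^ T) (k !)) ⟨
    s * (k * (N * N) * k ^ T * k !)
      ≡⟨ *-assoc s (k * (N * N) * k ^ T) (k !) ⟨
    s * (k * (N * N) * k ^ T) * k !
      ≤⟨ *-mono-≤ bad-ratio (k!≤permCount k) ⟩
    d ^ (T + T) * permCount k
      ≡⟨ *-comm (d ^ (T + T)) (permCount k) ⟩
    permCount k * d ^ (T + T) ∎)
    where open ≤-Reasoning

lemma3p1 : ∀ (m : ℕ) → ∃[ K ] (∀ (k : ℕ) → K ≤ k → suc m * badCount k ≤ permCount k)
lemma3p1 m = c * c + 1440000 , λ k K≤k →
  badCount-bound (suc m) k (≤-trans (m≤n+m 1440000 (c * c)) K≤k) (≤threshold k c (≤-trans (m≤m+n (c * c) 1440000) K≤k))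
  where
  c = suc m * 61 ^ 3
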